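{- Let $G$ be a connected graph, let $S\subseteq V(G)$, let $x,y$ be integers with $x\geq 1$ and $y\geq 0$, let $r\in V(G)$, and let $R:=N_G(r)$. Suppose there exists a set $X\subseteq V(G)\setminus\{r\}$ with $|X|\leq x$ such that: (1) for every $v\in X$, there is a path in $G$ from $r$ to $v$ internally disjoint from $X$; (2) for every connected component $C$ of $G-X-r$ containing a vertex of $R$, $\mathrm{ppw}(x,C,S\cap V(C))\leq y$; (3) for every minor $G'$ of $G$ with $|V(G')|<|V(G)|$ for which there exist a model $\mathcal M$ of $G'$ in $G$ and a vertex $r'$ of $G'$ whose branch set in $\mathcal M$ contains $r$, letting $S'$ be the set of vertices of $G'$ whose branch sets in $\mathcal M$ contain at least one vertex of $S$, there exists an $x$-partition-path-decomposition of $(G',S')$ of width at most $y+2$ whose associated partition contains the part $\{r'\}$ and whose associated path-decomposition has $\{r'\}$ in its first bag. Then there exists an $x$-partition-path-decomposition of $(G,S)$ of width at most $y+2$ whose associated partition contains the part $\{r\}$ and whose associated path-decomposition has $\{r\}$ in its first bag.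
   Context: $N_G(r)$ is the set of neighbors of $r$. A model of $H$ in $G$ is a collection of pairwise disjoint sets $\{W_v\subseteq V(G)\mid v\in V(H)\}$ (branch sets), each inducing a connected subgraph, such that for every edge $vw$ of $H$ some vertex of $W_v$ is adjacent to some vertex of $W_w$. A partition of a set is a collection of nonempty pairwise disjoint parts covering it; its width is the maximum part size; the quotient $H/\mathcal P$ has vertex set $\mathcal P$, with distinct parts adjacent iff some vertex of one is adjacent in $H$ to some vertex of the other. A path-decomposition is a sequence of bags $B_1,\dots,B_m$ forming a tree-decomposition indexed by a path, with width the max bag size minus one; $B_1$ is the first bag. For a positive integer $k$, a $k$-partition-path-decomposition of $(G,S)$ consists of an induced subgraph $H$ of $G$ with $S\subseteq V(H)$ (the associated subgraph), a partition $\mathcal P_H$ of $V(H)$ of width at most $k$ (the associated partition), and a path-decomposition $\mathcal D_H$ of $H/\mathcal P_H$ (the associated path-decomposition) such that for every connected component $C$ of $G-V(H)$ there is a bag $B$ of $\mathcal D_H$ with $N_G(V(C))$ contained in the union of the parts in $B$. Its width is the width of $\mathcal D_H$. $\mathrm{ppw}(k,G,S)$ is the minimum width of a $k$-partition-path-decomposition of $(G,S)$. -}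

module Defs where

open import Data.Nat using (ℕ; suc; _≤_; _<_)
open import Data.Bool using (Bool; true; false; T; _∧_)
open import Data.Fin using (Fin; toℕ; _≟_)
open import Data.Fin.Subset using (Subset; _∈_; _∉_; ∣_∣)
open import Data.Vec using (tabulate; lookup)
open import Data.List using (List; []; _∷_; _++_; [_])
open import Data.List.Relation.Unary.All using (All)
open import Data.List.Relation.Unary.Linked using (Linked)
open import Data.List.Relation.Unary.Unique.Propositional using (Unique)
open import Data.Unit using () renaming (⊤ to Unit)
open import Data.Product using (Σ; ∃; _×_)
open import Relation.Nullary using (¬_)
open import Relation.Nullary.Decidable using (⌊_⌋)
open import Relation.Binary.PropositionalEquality using (_≡_; _≢_)

record Graph : Set where
  field
    n      : ℕ
    adj    : Fin n → Fin n → Bool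
    sym    : ∀ u v → adj u v ≡ adj v u
    irrefl : ∀ v → adj v v ≡ false

V : Graph → Set
V G = Fin (Graph.n G)

E : (G : Graph) → V G → V G → Set
E G u v = T (Graph.adj G u v)

-- vertex subsets are Data.Fin.Subset; "universes" / S are predicates
VPred : Graph → Set₁
VPred G = V G → Set

data WalkIn (G : Graph) (W : Subset (Graph.n G)) : V G → V G → Set where
  here : ∀ {u} → u ∈ W → WalkIn G W u u
  step : ∀ {u w v} → u ∈ W → E G u w → WalkIn G W w v → WalkIn G W u v

Connected : (G : Graph) → Subset (Graph.n G) → Set
Connected G W = (∃ λ v → v ∈ W) × (∀ u v → u ∈ W → v ∈ W → WalkIn G W u v)

Component : (G : Graph) → VPred G → Subset (Graph.n G) → Set
Component G U C =
  (∀ v → v ∈ C → U v) × Connected G C ×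
  (∀ (W : Subset (Graph.n G)) → (∀ v → v ∈ W → U v) → Connected G W →
     (∀ v → v ∈ C → v ∈ W) → ∀ v → v ∈ W → v ∈ C)

PathAvoiding : (G : Graph) → Subset (Graph.n G) → V G → V G → Set
PathAvoiding G X r v =
  Σ (List (V G)) λ inner →
    Linked (E G) (r ∷ inner ++ [ v ]) ×
    Unique (r ∷ inner ++ [ v ]) ×
    All (λ u → u ∉ X) inner

Part : ∀ {n m} → Subset n → (Fin n → Fin m) → Fin m → Subset n
Part H part i = tabulate λ v → lookup H v ∧ ⌊ part v ≟ i ⌋

record PPD (k : ℕ) (G : Graph) (U S : VPred G) : Set where
  field
    -- associated (induced) subgraph H of G[U], containing S
    H      : Subset (Graph.n G)
    H⊆U    : ∀ v → v ∈ H → U v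
    S⊆H    : ∀ v → S v → v ∈ H
    -- associated partition of V(H): parts labelled by Fin m
    m      : ℕ
    part   : V G → Fin m
    part-nonempty : ∀ i → ∃ λ v → v ∈ H × part v ≡ i
    part-width    : ∀ i → ∣ Part H part i ∣ ≤ k
    -- associated path-decomposition of H / P (bags B_0, ..., B_{ℓ-1})
    ℓ      : ℕ
    bag    : Fin ℓ → Subset m
    bag-cover : ∀ i → ∃ λ j → i ∈ bag j
    bag-edge  : ∀ i i' → i ≢ i' →
                (∃ λ u → ∃ λ u' → u ∈ H × u' ∈ H × part u ≡ i × part u' ≡ i' × E G u u') →
                ∃ λ j → i ∈ bag j × i' ∈ bag j
    bag-path  : ∀ i (a b c : Fin ℓ) → toℕ a ≤ toℕ b → toℕ b ≤ toℕ c →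
                i ∈ bag a → i ∈ bag c → i ∈ bag b
    comp : ∀ C → Component G (λ v → U v × v ∉ H) C →
           ∃ λ j → ∀ c w → c ∈ C → U w → w ∉ C → E G c w →
                     w ∈ H × part w ∈ bag j

-- width (max bag size minus one) at most w
Width≤ : ∀ {k G U S} → PPD k G U S → ℕ → Set
Width≤ d w = ∀ j → ∣ PPD.bag d j ∣ ≤ suc w

Rooted : ∀ {k G U S} → PPD k G U S → V G → Set
Rooted d r =
  r ∈ PPD.H d ×
  (∀ v → v ∈ PPD.H d → PPD.part d v ≡ PPD.part d r → v ≡ r) ×
  (∃ λ j → toℕ j ≡ 0 × PPD.part d r ∈ PPD.bag d j)

record Model (G' G : Graph) : Set where
  field
    branch   : V G' → Subset (Graph.n G)
    disjoint : ∀ a b → a ≢ b → ∀ v → v ∈ branch a → v ∉ branch b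
    conn     : ∀ a → Connected G (branch a)
    edges    : ∀ a b → E G' a b →
               ∃ λ u → ∃ λ v → u ∈ branch a × v ∈ branch b × E G u v

ImageSet : ∀ {G' G} → Model G' G → VPred G → VPred G'
ImageSet M S a = ∃ λ s → S s × s ∈ Model.branch M a

Everything : (G : Graph) → VPred G
Everything G _ = Unit

-- Let A be the component of G − X containing r. Hypothesis (1) makes A ∪ X
-- connected, so contracting it onto r gives a proper minor G′, which by
-- hypothesis (3) has a decomposition of width ≤ y + 2 with the part {r′} in its
-- first bag; in G the part {r′} is replaced by the part X, of size ≤ x. Each
-- component of G − X − r inside A has a decomposition of width ≤ y by
-- hypothesis (2), and adding the parts X and {r} to all its bags costs 2.
-- Concatenating the bag {X, r}, these component decompositions one after the
-- other, and the decomposition of G′ gives the result: X lies in every bag up to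
-- an initial segment of G′'s bags, r only in the bags before G′'s, and a
-- component of G − X − r inside A is adjacent only to itself, X and r. If
-- nothing can be contracted, G is the single vertex r.

module Submission where

open import Defs
open import Data.Nat using (ℕ; _≤_; _<_; _+_)
open import Data.Fin.Subset using (Subset; _∈_; _∉_; ∣_∣; ⊤)
open import Data.Product using (Σ; ∃; _×_)
open import Relation.Binary.PropositionalEquality using (_≢_)

open import Data.Nat using (zero; suc; z≤n; s≤s)
import Data.Nat.Properties as ℕ
open import Data.Bool using (true; false; T; _∧_)
open import Data.Bool.Properties using (T?; T-≡; T-∧; T-irrelevant)
open import Data.Fin as Fin using (Fin; zero; suc; toℕ; _≟_; _↑ˡ_; _↑ʳ_)
import Data.Fin.Properties as Fin
open import Data.Fin.Subset using (∁; _∪_; ⁅_⁆; _⊆_)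
open import Data.Fin.Subset.Properties
  using (_∈?_; nonempty?; p⊂q⇒∣p∣<∣q∣; p⊆q⇒∣p∣≤∣q∣; ∣⊤∣≡n; ∣p∣≤n; ∈⊤; x∈⁅x⁆; x∈⁅y⁆⇒x≡y; ∣⁅x⁆∣≡1;
         x∈p∪q⁺; x∈p∪q⁻; x∈∁p⇒x∉p; x∉p⇒x∈∁p; ⊆-antisym)
open import Data.Vec using ([]; _∷_; here; there; tabulate)
import Data.Vec.Properties as Vec
open import Data.List as List using (List; []; _∷_; _++_; [_]; concat)
open import Data.List.Relation.Unary.All as All using (All; []; _∷_)
import Data.List.Relation.Unary.All.Properties as All
open import Data.List.Relation.Unary.Any as Any using (Any; here; there)
import Data.List.Relation.Unary.Any.Properties as Any
open import Data.List.Relation.Unary.Linked using (Linked; [-]; _∷_)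
import Data.List.Membership.Propositional.Properties as ∈ₗ
open import Data.Product using (∃₂; _,_; proj₁; proj₂)
open import Data.Sum using (_⊎_; inj₁; inj₂; [_,_]′)
open import Data.Unit using (tt) renaming (⊤ to Unit)
open import Function using (_∘_; Equivalence; mk⇔)
open import Relation.Nullary using (¬_; Dec; yes; no; contradiction)
open import Relation.Nullary.Decidable
  using (⌊_⌋; True; toWitness; fromWitness; ¬?; _×-dec_; _⊎-dec_; isYes≗does; does-⇔; dec-false)
open import Relation.Unary using (Decidable)
open import Relation.Binary.PropositionalEquality
  using (_≡_; refl; sym; trans; cong; cong₂; subst; module ≡-Reasoning)

toSubset : ∀ {n} {P : Fin n → Set} → Decidable P → Subset n
toSubset P? = tabulate (⌊_⌋ ∘ P?)

module _ {n} {P : Fin n → Set} (P? : Decidable P) where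

  ∈-toSubset⁺ : ∀ {i} → P i → i ∈ toSubset P?
  ∈-toSubset⁺ {i} p = Vec.lookup⇒[]= i _
    (trans (Vec.lookup∘tabulate _ i) (Equivalence.to T-≡ (fromWitness p)))

  ∈-toSubset⁻ : ∀ {i} → i ∈ toSubset P? → P i
  ∈-toSubset⁻ {i} h = toWitness {a? = P? i} (Equivalence.from T-≡
    (trans (sym (Vec.lookup∘tabulate _ i)) (Vec.[]=⇒lookup h)))

module _ {n m} {H : Subset n} {part : Fin n → Fin m} {i : Fin m} where

  ∈-Part⁺ : ∀ {v} → v ∈ H → part v ≡ i → v ∈ Part H part i
  ∈-Part⁺ {v} v∈H refl = Vec.lookup⇒[]= v _ (trans (Vec.lookup∘tabulate _ v)
    (cong₂ _∧_ (Vec.[]=⇒lookup v∈H) (Equivalence.to T-≡ (fromWitness {a? = part v ≟ part v} refl))))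

  ∈-Part⁻ : ∀ {v} → v ∈ Part H part i → v ∈ H × part v ≡ i
  ∈-Part⁻ {v} h with Equivalence.to T-∧ (Equivalence.from T-≡
      (trans (sym (Vec.lookup∘tabulate _ v)) (Vec.[]=⇒lookup h)))
  ... | v∈H , same = Vec.lookup⇒[]= v H (Equivalence.to T-≡ v∈H) , toWitness same

enum : ∀ {n} (p : Subset n) → Fin ∣ p ∣ → Fin n
enum (true ∷ p)  zero    = zero
enum (true ∷ p)  (suc k) = suc (enum p k)
enum (false ∷ p) k       = suc (enum p k)

enum-∈ : ∀ {n} (p : Subset n) k → enum p k ∈ p
enum-∈ (true ∷ p)  zero    = here
enum-∈ (true ∷ p)  (suc k) = there (enum-∈ p k)
enum-∈ (false ∷ p) k       = there (enum-∈ p k)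

enum-injective : ∀ {n} (p : Subset n) {k l} → enum p k ≡ enum p l → k ≡ l
enum-injective (true ∷ p)  {zero}  {zero}  _  = refl
enum-injective (true ∷ p)  {suc k} {suc l} eq = cong suc (enum-injective p (Fin.suc-injective eq))
enum-injective (false ∷ p) eq = enum-injective p (Fin.suc-injective eq)

index : ∀ {n} (p : Subset n) {i} → i ∈ p → Fin ∣ p ∣
index (true ∷ p)  here      = zero
index (true ∷ p)  (there h) = suc (index p h)
index (false ∷ p) (there h) = index p h

enum-index : ∀ {n} (p : Subset n) {i} (h : i ∈ p) → enum p (index p h) ≡ i
enum-index (true ∷ p)  here      = refl
enum-index (true ∷ p)  (there h) = cong suc (enum-index p h)
enum-index (false ∷ p) (there h) = cong suc (enum-index p h)

injection⇒∣p∣≤∣q∣ : ∀ {n n′} {p : Subset n} {q : Subset n′} (f : ∀ i → i ∈ p → Fin n′) →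
  (∀ i h → f i h ∈ q) → (∀ i j hi hj → f i hi ≡ f j hj → i ≡ j) → ∣ p ∣ ≤ ∣ q ∣
injection⇒∣p∣≤∣q∣ {p = p} {q} f f∈q f-inj = Fin.injective⇒≤ {f = f′} f′-injective
  where
  f′ : Fin ∣ p ∣ → Fin ∣ q ∣
  f′ k = index q (f∈q (enum p k) (enum-∈ p k))
  f′-injective : ∀ {k l} → f′ k ≡ f′ l → k ≡ l
  f′-injective {k} {l} eq = enum-injective p (f-inj _ _ _ _ (begin
    f (enum p k) _             ≡⟨ enum-index q _ ⟨
    enum q (f′ k)              ≡⟨ cong (enum q) eq ⟩
    enum q (f′ l)              ≡⟨ enum-index q _ ⟩
    f (enum p l) _             ∎))
    where open ≡-Reasoning

∣p∪q∣≤∣p∣+∣q∣ : ∀ {n} (p q : Subset n) → ∣ p ∪ q ∣ ≤ ∣ p ∣ + ∣ q ∣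
∣p∪q∣≤∣p∣+∣q∣ []          []          = z≤n
∣p∪q∣≤∣p∣+∣q∣ (true ∷ p)  (true ∷ q)  =
  s≤s (ℕ.≤-trans (∣p∪q∣≤∣p∣+∣q∣ p q) (ℕ.+-monoʳ-≤ ∣ p ∣ (ℕ.n≤1+n ∣ q ∣)))
∣p∪q∣≤∣p∣+∣q∣ (true ∷ p)  (false ∷ q) = s≤s (∣p∪q∣≤∣p∣+∣q∣ p q)
∣p∪q∣≤∣p∣+∣q∣ (false ∷ p) (true ∷ q)  =
  ℕ.≤-trans (s≤s (∣p∪q∣≤∣p∣+∣q∣ p q)) (ℕ.≤-reflexive (sym (ℕ.+-suc ∣ p ∣ ∣ q ∣)))
∣p∪q∣≤∣p∣+∣q∣ (false ∷ p) (false ∷ q) = ∣p∪q∣≤∣p∣+∣q∣ p q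

↑ˡ≢↑ʳ : ∀ {m n} (i : Fin m) (j : Fin n) → i ↑ˡ n ≢ m ↑ʳ j
↑ˡ≢↑ʳ {m} {n} i j eq
  with trans (sym (Fin.splitAt-↑ˡ m i n)) (trans (cong (Fin.splitAt m) eq) (Fin.splitAt-↑ʳ m n j))
... | ()

image : ∀ {m n} → (Fin m → Fin n) → Subset m → Subset n
image f B = toSubset (λ i → Fin.any? (λ p → (p ∈? B) ×-dec (f p ≟ i)))

module _ {m n} {f : Fin m → Fin n} {B : Subset m} where

  ∈-image⁺ : ∀ {p} → p ∈ B → f p ∈ image f B
  ∈-image⁺ {p} p∈B = ∈-toSubset⁺ _ (p , p∈B , refl)

  ∈-image⁻ : ∀ {i} → i ∈ image f B → ∃ λ p → p ∈ B × f p ≡ i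
  ∈-image⁻ = ∈-toSubset⁻ _

  ∣image∣≤ : ∣ image f B ∣ ≤ ∣ B ∣
  ∣image∣≤ = injection⇒∣p∣≤∣q∣ (λ i h → proj₁ (∈-image⁻ h)) (λ i h → proj₁ (proj₂ (∈-image⁻ h)))
    (λ i j hi hj eq → trans (sym (proj₂ (proj₂ (∈-image⁻ hi))))
                        (trans (cong f eq) (proj₂ (proj₂ (∈-image⁻ hj)))))

  injective⇒∈-image⁻ : (∀ {p q} → f p ≡ f q → p ≡ q) → ∀ {p} → f p ∈ image f B → p ∈ B
  injective⇒∈-image⁻ f-inj h with ∈-image⁻ h
  ... | q , q∈B , eq = subst (_∈ B) (f-inj eq) q∈B

-- Some element of p, chosen from p alone; d is returned only when p is empty.
pick : ∀ {n} → Subset n → Fin n → Fin n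
pick p d with nonempty? p
... | yes (i , _) = i
... | no _        = d

pick-∈ : ∀ {n} {p : Subset n} {i} d → i ∈ p → pick p d ∈ p
pick-∈ {p = p} d i∈p with nonempty? p
... | yes (_ , h) = h
... | no empty    = contradiction (_ , i∈p) empty

pick-default-irrelevant : ∀ {n} {p : Subset n} {i} d d′ → i ∈ p → pick p d ≡ pick p d′
pick-default-irrelevant {p = p} d d′ i∈p with nonempty? p
... | yes _    = refl
... | no empty = contradiction (_ , i∈p) empty

∉⇒∣p∣<n : ∀ {n} {p : Subset n} {i} → i ∉ p → ∣ p ∣ < n
∉⇒∣p∣<n {n} {p} {i} i∉p = subst (∣ p ∣ <_) (∣⊤∣≡n n) (p⊂q⇒∣p∣<∣q∣ ((λ _ → ∈⊤) , i , ∈⊤ , i∉p))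

preimage : ∀ {m n} → (Fin m → Fin n) → Subset n → Subset m
preimage f B = toSubset (λ p → f p ∈? B)

module _ {m n} {f : Fin m → Fin n} {B : Subset n} where

  ∈-preimage⁺ : ∀ {p} → f p ∈ B → p ∈ preimage f B
  ∈-preimage⁺ = ∈-toSubset⁺ _

  ∈-preimage⁻ : ∀ {p} → p ∈ preimage f B → f p ∈ B
  ∈-preimage⁻ = ∈-toSubset⁻ _

  ∣preimage∣≤ : (∀ {p q} → f p ≡ f q → p ≡ q) → ∣ preimage f B ∣ ≤ ∣ B ∣
  ∣preimage∣≤ f-inj = injection⇒∣p∣≤∣q∣ (λ p _ → f p) (λ p h → ∈-preimage⁻ h) (λ p q _ _ → f-inj)

Convex : ∀ {ℓ} → (Fin ℓ → Set) → Set
Convex Q = ∀ a b c → toℕ a ≤ toℕ b → toℕ b ≤ toℕ c → Q a → Q c → Q b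

convex-suc : ∀ {ℓ} {Q : Fin (suc ℓ) → Set} → Convex Q → Convex (Q ∘ suc)
convex-suc conv a b c a≤b b≤c = conv (suc a) (suc b) (suc c) (s≤s a≤b) (s≤s b≤c)

convex-⇔ : ∀ {ℓ} {Q Q′ : Fin ℓ → Set} → (∀ j → Q j → Q′ j) → (∀ j → Q′ j → Q j) →
  Convex Q → Convex Q′
convex-⇔ to from conv a b c a≤b b≤c qa qc = to b (conv a b c a≤b b≤c (from a qa) (from c qc))

-- The path condition for a list of bags: the entries satisfying P form one
-- (possibly empty) block, which in Prefixed P starts the list.

module _ {A : Set} (P : A → Set) where

  data Prefixed : List A → Set where
    stop : ∀ {xs} → All (¬_ ∘ P) xs → Prefixed xs
    _∷_  : ∀ {x xs} → P x → Prefixed xs → Prefixed (x ∷ xs)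

  data Contiguous : List A → Set where
    start : ∀ {xs} → Prefixed xs → Contiguous xs
    skip  : ∀ {x xs} → ¬ P x → Contiguous xs → Contiguous (x ∷ xs)

module _ {A : Set} {P : A → Set} where

  prefixed-++-none : ∀ {xs ys} → Prefixed P xs → All (¬_ ∘ P) ys → Prefixed P (xs ++ ys)
  prefixed-++-none (stop none) none′ = stop (All.++⁺ none none′)
  prefixed-++-none (px ∷ h)    none′ = px ∷ prefixed-++-none h none′

  all-++-prefixed : ∀ {xs ys} → All P xs → Prefixed P ys → Prefixed P (xs ++ ys)
  all-++-prefixed []         h = h
  all-++-prefixed (px ∷ pxs) h = px ∷ all-++-prefixed pxs h

  contiguous-++-none : ∀ {xs ys} → Contiguous P xs → All (¬_ ∘ P) ys → Contiguous P (xs ++ ys)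
  contiguous-++-none (start h)    none = start (prefixed-++-none h none)
  contiguous-++-none (skip ¬px h) none = skip ¬px (contiguous-++-none h none)

  none-++-contiguous : ∀ {xs ys} → All (¬_ ∘ P) xs → Contiguous P ys → Contiguous P (xs ++ ys)
  none-++-contiguous []           h = h
  none-++-contiguous (¬px ∷ none) h = skip ¬px (none-++-contiguous none h)

  contiguous-concat : ∀ {n} (g : Fin n → List A) u → Contiguous P (g u) →
    (∀ u′ → u′ ≢ u → All (¬_ ∘ P) (g u′)) → Contiguous P (concat (List.tabulate g))
  contiguous-concat g zero    h others = contiguous-++-none h
    (All.concat⁺ (All.tabulate⁺ λ u′ → others (suc u′) λ ()))
  contiguous-concat g (suc u) h others = none-++-contiguous (others zero λ ())
    (contiguous-concat (g ∘ suc) u h λ u′ u′≢u → others (suc u′) (u′≢u ∘ Fin.suc-injective))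

  module _ (P? : Decidable P) where

    head-prefixed : ∀ ℓ (f : Fin (suc ℓ) → A) → Convex (P ∘ f) → P (f zero) →
      Prefixed P (List.tabulate f)
    head-prefixed zero    f conv p₀ = p₀ ∷ stop []
    head-prefixed (suc ℓ) f conv p₀ with P? (f (suc zero))
    ... | yes p₁ = p₀ ∷ head-prefixed ℓ (f ∘ suc) (convex-suc conv) p₁
    ... | no ¬p₁ = p₀ ∷ stop (All.tabulate⁺ λ k pₖ →
                     ¬p₁ (conv zero (suc zero) (suc k) z≤n (s≤s z≤n) p₀ pₖ))

    tabulate-prefixed : ∀ {ℓ} (f : Fin ℓ → A) → Convex (P ∘ f) →
      ∀ j → toℕ j ≡ 0 → P (f j) → Prefixed P (List.tabulate f)
    tabulate-prefixed {suc ℓ} f conv zero _ = head-prefixed ℓ f conv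

    tabulate-contiguous : ∀ {ℓ} (f : Fin ℓ → A) → Convex (P ∘ f) → Contiguous P (List.tabulate f)
    tabulate-contiguous {zero}  f conv = start (stop [])
    tabulate-contiguous {suc ℓ} f conv with P? (f zero)
    ... | yes p₀ = start (head-prefixed _ f conv p₀)
    ... | no ¬p₀ = skip ¬p₀ (tabulate-contiguous (f ∘ suc) (convex-suc conv))

  prefixed⇒downward : ∀ {xs} → Prefixed P xs → ∀ b c → toℕ b ≤ toℕ c →
    P (List.lookup xs c) → P (List.lookup xs b)
  prefixed⇒downward (stop none) b       c       _         pc =
    contradiction pc (All.lookup none (∈ₗ.∈-lookup c))
  prefixed⇒downward (px ∷ h)    zero    c       _         _  = px
  prefixed⇒downward (px ∷ h)    (suc b) (suc c) (s≤s b≤c) pc = prefixed⇒downward h b c b≤c pc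

  contiguous⇒convex : ∀ {xs} → Contiguous P xs → Convex (P ∘ List.lookup xs)
  contiguous⇒convex (start h)    _       b       c       _         b≤c       _  pc =
    prefixed⇒downward h b c b≤c pc
  contiguous⇒convex (skip ¬px h) zero    _       _       _         _         pa _  =
    contradiction pa ¬px
  contiguous⇒convex (skip ¬px h) (suc a) (suc b) (suc c) (s≤s a≤b) (s≤s b≤c) pa pc =
    contiguous⇒convex h a b c a≤b b≤c pa pc

E? : (G : Graph) → ∀ u v → Dec (E G u v)
E? G u v = T? (Graph.adj G u v)

module _ {G : Graph} where

  E-sym : ∀ {u v} → E G u v → E G v u
  E-sym {u} {v} = subst T (Graph.sym G u v)

  module _ {W : Subset (Graph.n G)} where

    walk-source : ∀ {u v} → WalkIn G W u v → u ∈ W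
    walk-source (here u∈W)     = u∈W
    walk-source (step u∈W _ _) = u∈W

    walk-target : ∀ {u v} → WalkIn G W u v → v ∈ W
    walk-target (here v∈W)   = v∈W
    walk-target (step _ _ p) = walk-target p

    infixr 5 _++ʷ_
    _++ʷ_ : ∀ {u v w} → WalkIn G W u v → WalkIn G W v w → WalkIn G W u w
    here _       ++ʷ q = q
    step u∈W e p ++ʷ q = step u∈W e (p ++ʷ q)

    walk-snoc : ∀ {u v w} → WalkIn G W u v → E G v w → w ∈ W → WalkIn G W u w
    walk-snoc p e w∈W = p ++ʷ step (walk-target p) e (here w∈W)

    walk-reverse : ∀ {u v} → WalkIn G W u v → WalkIn G W v u
    walk-reverse (here u∈W)     = here u∈W
    walk-reverse (step u∈W e p) = walk-snoc (walk-reverse p) (E-sym e) u∈W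

    Closed : Subset (Graph.n G) → Set
    Closed R = ∀ u v → u ∈ R → v ∈ W → E G u v → v ∈ R

    closed-walk : ∀ {R} → Closed R → ∀ {u v} → u ∈ R → WalkIn G W u v → v ∈ R
    closed-walk R-closed u∈R (here _)     = u∈R
    closed-walk R-closed u∈R (step _ e p) = closed-walk R-closed (R-closed _ _ u∈R (walk-source p) e) p

    closed-walk-inside : ∀ {R} → Closed R → ∀ {u v} → u ∈ R → WalkIn G W u v → WalkIn G R u v
    closed-walk-inside R-closed u∈R (here _)     = here u∈R
    closed-walk-inside R-closed u∈R (step _ e p) =
      step u∈R e (closed-walk-inside R-closed (R-closed _ _ u∈R (walk-source p) e) p)

  walk-mono : ∀ {W W′ : Subset (Graph.n G)} → W ⊆ W′ → ∀ {u v} → WalkIn G W u v → WalkIn G W′ u v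
  walk-mono W⊆W′ (here u∈W)     = here (W⊆W′ u∈W)
  walk-mono W⊆W′ (step u∈W e p) = step (W⊆W′ u∈W) e (walk-mono W⊆W′ p)

-- Breadth-first layers; they stabilise within n steps since every step that
-- does not stabilise adds a vertex.

module Reach (G : Graph) (W : Subset (Graph.n G)) (s : V G) where

  private
    n = Graph.n G

    grow : Subset n → Subset n
    grow R = toSubset (λ v → (v ∈? R) ⊎-dec ((v ∈? W) ×-dec Fin.any? (λ u → (u ∈? R) ×-dec E? G u v)))

    layer : ℕ → Subset n
    layer zero    = toSubset (λ v → (v ≟ s) ×-dec (v ∈? W))
    layer (suc k) = grow (layer k)

    layer-walk : ∀ k {v} → v ∈ layer k → WalkIn G W s v
    layer-walk zero    h with ∈-toSubset⁻ _ h
    ... | refl , s∈W = here s∈W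
    layer-walk (suc k) h with ∈-toSubset⁻ _ h
    ... | inj₁ h′                = layer-walk k h′
    ... | inj₂ (v∈W , u , h′ , e) = walk-snoc (layer-walk k h′) e v∈W

    layer-⊆-suc : ∀ k → layer k ⊆ layer (suc k)
    layer-⊆-suc k h = ∈-toSubset⁺ _ (inj₁ h)

    layer-closed-or-large : ∀ k → Closed {G} {W} (layer k) ⊎ k ≤ ∣ layer k ∣
    layer-closed-or-large zero    = inj₂ z≤n
    layer-closed-or-large (suc k)
      with Fin.any? (λ v → (v ∈? layer (suc k)) ×-dec ¬? (v ∈? layer k))
    ... | no nothing-new = inj₁ λ u v u∈ v∈W e → ∈-toSubset⁺ _ (inj₂ (v∈W , u , old u u∈ , e))
      where
      old : ∀ u → u ∈ layer (suc k) → u ∈ layer k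
      old u u∈ with u ∈? layer k
      ... | yes h = h
      ... | no ¬h = contradiction (u , u∈ , ¬h) nothing-new
    ... | yes (v , v∈ , v∉) = inj₂ (ℕ.≤-<-trans k≤ (p⊂q⇒∣p∣<∣q∣ (layer-⊆-suc k , v , v∈ , v∉)))
      where
      k≤ : k ≤ ∣ layer k ∣
      k≤ with layer-closed-or-large k | ∈-toSubset⁻ _ v∈
      ... | inj₂ le                 | _                        = le
      ... | inj₁ _                  | inj₁ h                   = contradiction h v∉
      ... | inj₁ closed             | inj₂ (v∈W , u , u∈ , e)  = contradiction (closed u v u∈ v∈W e) v∉

  reach : Subset n
  reach = layer (suc n)

  reach-closed : Closed {G} {W} reach
  reach-closed with layer-closed-or-large (suc n)
  ... | inj₁ closed = closed
  ... | inj₂ large  = contradiction large (ℕ.<⇒≱ (s≤s (∣p∣≤n (layer (suc n)))))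

  private
    layer-⊆-reach : ∀ k → layer zero ⊆ layer k
    layer-⊆-reach zero    h = h
    layer-⊆-reach (suc k) h = layer-⊆-suc k (layer-⊆-reach k h)

  reach⁺ : ∀ {v} → WalkIn G W s v → v ∈ reach
  reach⁺ p = closed-walk reach-closed (layer-⊆-reach (suc n) (∈-toSubset⁺ _ (refl , walk-source p))) p

  reach⁻ : ∀ {v} → v ∈ reach → WalkIn G W s v
  reach⁻ = layer-walk (suc n)

  reach-walk : ∀ {v} → v ∈ reach → WalkIn G reach s v
  reach-walk h = closed-walk-inside reach-closed (reach⁺ (here (walk-source (reach⁻ h)))) (reach⁻ h)

open Reach public using (reach)

module _ {G : Graph} where

  component-restrict : ∀ {U U′ : VPred G} {C} → Component G U C →
    (∀ v → v ∈ C → U′ v) → (∀ v → U′ v → U v) → Component G U′ C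
  component-restrict (_ , C-connected , C-maximal) C⊆U′ U′⊆U =
    C⊆U′ , C-connected , λ W′ W′⊆U′ → C-maximal W′ (λ v h → U′⊆U v (W′⊆U′ v h))

  reach-component : (U : VPred G) {W : Subset (Graph.n G)} → (∀ v → v ∈ W → U v) → (∀ v → U v → v ∈ W) →
    ∀ {s} → s ∈ W → Component G U (reach G W s)
  reach-component U {W} W⊆U U⊆W {s} s∈W =
    (λ v h → W⊆U v (walk-target (reach⁻ h))) ,
    ((s , reach⁺ (here s∈W)) , λ u v hu hv → walk-reverse (reach-walk hu) ++ʷ reach-walk hv) ,
    λ W′ W′⊆U W′-connected C⊆W′ v v∈W′ →
      reach⁺ (walk-mono (λ h → U⊆W _ (W′⊆U _ h)) (proj₂ W′-connected s v (C⊆W′ s (reach⁺ (here s∈W))) v∈W′))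
    where open Reach G W s

module Contraction (G : Graph) {m : ℕ} (κ : V G → Fin m) where

  fiber : Fin m → Subset (Graph.n G)
  fiber a = toSubset (λ v → κ v ≟ a)

  ∈-fiber⁺ : ∀ {v a} → κ v ≡ a → v ∈ fiber a
  ∈-fiber⁺ = ∈-toSubset⁺ _

  ∈-fiber⁻ : ∀ {v a} → v ∈ fiber a → κ v ≡ a
  ∈-fiber⁻ = ∈-toSubset⁻ _

  Joined : Fin m → Fin m → Set
  Joined a b = a ≢ b × ∃₂ λ u v → κ u ≡ a × κ v ≡ b × E G u v

  joined? : ∀ a b → Dec (Joined a b)
  joined? a b = ¬? (a ≟ b) ×-dec
    Fin.any? (λ u → Fin.any? (λ v → (κ u ≟ a) ×-dec ((κ v ≟ b) ×-dec E? G u v)))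

  joined-sym : ∀ {a b} → Joined a b → Joined b a
  joined-sym (a≢b , u , v , κu , κv , e) = (λ b≡a → a≢b (sym b≡a)) , v , u , κv , κu , E-sym {G} e

  quotient : Graph
  quotient = record
    { n      = m
    ; adj    = λ a b → ⌊ joined? a b ⌋
    ; sym    = λ a b → trans (isYes≗does (joined? a b))
                 (trans (does-⇔ (mk⇔ joined-sym joined-sym) (joined? a b) (joined? b a))
                   (sym (isYes≗does (joined? b a))))
    ; irrefl = λ a → trans (isYes≗does (joined? a a)) (dec-false (joined? a a) λ j → proj₁ j refl)
    }

  E-quotient⁻ : ∀ {a b} → E quotient a b → Joined a b
  E-quotient⁻ = toWitness

  E-quotient⁺ : ∀ {u v} → κ u ≢ κ v → E G u v → E quotient (κ u) (κ v)
  E-quotient⁺ κu≢κv e = fromWitness (κu≢κv , _ , _ , refl , refl , e)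

  walk-contract : ∀ {W u v} → WalkIn G W u v → WalkIn quotient (image κ W) (κ u) (κ v)
  walk-contract (here u∈W) = here (∈-image⁺ u∈W)
  walk-contract {W} {_} {v} (step {u} {w} u∈W e p) with κ u ≟ κ w
  ... | yes κu≡κw = subst (λ a → WalkIn quotient (image κ W) a (κ v)) (sym κu≡κw) (walk-contract p)
  ... | no κu≢κw  = step (∈-image⁺ u∈W) (E-quotient⁺ κu≢κw e) (walk-contract p)

  module _ (fiber-connected : ∀ a → Connected G (fiber a)) where

    fiberModel : Model quotient G
    fiberModel = record
      { branch   = fiber
      ; disjoint = λ a b a≢b v va vb → a≢b (trans (sym (∈-fiber⁻ va)) (∈-fiber⁻ vb))
      ; conn     = fiber-connected
      ; edges    = λ a b e → let (_ , u , v , κu , κv , uv) = E-quotient⁻ e in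
                     u , v , ∈-fiber⁺ κu , ∈-fiber⁺ κv , uv
      }

    private
      within-fiber : ∀ {W′ a u v} → a ∈ W′ → κ u ≡ a → κ v ≡ a → WalkIn G (preimage κ W′) u v
      within-fiber {a = a} a∈W′ κu κv =
        walk-mono (λ h → ∈-preimage⁺ (subst (_∈ _) (sym (∈-fiber⁻ h)) a∈W′))
          (proj₂ (fiber-connected a) _ _ (∈-fiber⁺ κu) (∈-fiber⁺ κv))

    walk-lift : ∀ {W′ a b u v} → WalkIn quotient W′ a b → κ u ≡ a → κ v ≡ b → WalkIn G (preimage κ W′) u v
    walk-lift (here a∈W′) κu κv = within-fiber a∈W′ κu κv
    walk-lift (step a∈W′ e p) κu κv with E-quotient⁻ e
    ... | _ , u′ , v′ , κu′ , κv′ , u′v′ =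
      within-fiber a∈W′ κu κu′ ++ʷ
      step (∈-preimage⁺ (subst (_∈ _) (sym κu′) a∈W′)) u′v′ (walk-lift p κv′ κv)

    component-image : ∀ {U′ : VPred quotient} {C} → Component G (U′ ∘ κ) C → Component quotient U′ (image κ C)
    component-image {U′} {C} (C⊆U , ((c₀ , c₀∈C) , C-walk) , C-maximal) =
      image⊆U′ , ((κ c₀ , ∈-image⁺ c₀∈C) , image-walk) , image-maximal
      where
      image⊆U′ : ∀ a → a ∈ image κ C → U′ a
      image⊆U′ a h with ∈-image⁻ h
      ... | c , c∈C , refl = C⊆U c c∈C

      image-walk : ∀ a b → a ∈ image κ C → b ∈ image κ C → WalkIn quotient (image κ C) a b
      image-walk a b ha hb with ∈-image⁻ ha | ∈-image⁻ hb
      ... | c , c∈C , refl | c′ , c′∈C , refl = walk-contract (C-walk c c′ c∈C c′∈C)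

      image-maximal : ∀ W′ → (∀ a → a ∈ W′ → U′ a) → Connected quotient W′ →
                      (∀ a → a ∈ image κ C → a ∈ W′) → ∀ a → a ∈ W′ → a ∈ image κ C
      image-maximal W′ W′⊆U′ (_ , W′-walk) image⊆W′ a a∈W′ with proj₁ (fiber-connected a)
      ... | v , v∈fiber = subst (_∈ image κ C) (∈-fiber⁻ v∈fiber) (∈-image⁺ (C-maximal (preimage κ W′)
            (λ u h → W′⊆U′ (κ u) (∈-preimage⁻ h))
            ((c₀ , C⊆preimage c₀ c₀∈C) , λ u u′ hu hu′ →
               walk-lift (W′-walk (κ u) (κ u′) (∈-preimage⁻ hu) (∈-preimage⁻ hu′)) refl refl)
            C⊆preimage v (∈-preimage⁺ (subst (_∈ W′) (sym (∈-fiber⁻ v∈fiber)) a∈W′))))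
        where
        C⊆preimage : ∀ c → c ∈ C → c ∈ preimage κ W′
        C⊆preimage c c∈C = ∈-preimage⁺ (image⊆W′ (κ c) (∈-image⁺ c∈C))

-- A partition-path-decomposition described by labelling the vertices of H
-- with labels from an arbitrary Fin N: the parts are the nonempty label
-- classes, so unused labels are allowed.

record Draft (k w : ℕ) (G : Graph) (S : VPred G) (r : V G) : Set where
  field
    N              : ℕ
    H              : Subset (Graph.n G)
    S⊆H            : ∀ v → S v → v ∈ H
    label          : V G → Fin N
    class-width    : ∀ v → v ∈ H → ∣ Part H label (label v) ∣ ≤ k
    firstBag       : Subset N
    laterBags      : List (Subset N)
    bag-width      : All (λ B → ∣ B ∣ ≤ suc w) (firstBag ∷ laterBags)
    bag-cover      : ∀ v → v ∈ H → Any (label v ∈_) (firstBag ∷ laterBags)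
    bag-edge       : ∀ u v → u ∈ H → v ∈ H → label u ≢ label v → E G u v →
                     Any (λ B → label u ∈ B × label v ∈ B) (firstBag ∷ laterBags)
    bag-contiguous : ∀ v → v ∈ H → Contiguous (label v ∈_) (firstBag ∷ laterBags)
    bag-comp       : ∀ C → Component G (λ v → Everything G v × v ∉ H) C →
                     Any (λ B → ∀ c v → c ∈ C → v ∉ C → E G c v → v ∈ H × label v ∈ B)
                         (firstBag ∷ laterBags)
    root∈H         : r ∈ H
    root-alone     : ∀ v → v ∈ H → label v ≡ label r → v ≡ r
    root-first     : label r ∈ firstBag

module _ {k w G S r} (D : Draft k w G S r) where

  open Draft D

  private
    bags : List (Subset N)
    bags = firstBag ∷ laterBags

    used : Subset N
    used = toSubset (λ i → Fin.any? (λ v → (v ∈? H) ×-dec (label v ≟ i)))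

    label-used : ∀ {v} → v ∈ H → label v ∈ used
    label-used {v} v∈H = ∈-toSubset⁺ _ (v , v∈H , refl)

    -- labels outside `used` are sent to the part of the root
    compress : Fin N → Fin ∣ used ∣
    compress i with i ∈? used
    ... | yes h = index used h
    ... | no _  = index used (label-used root∈H)

    enum-compress : ∀ {i} → i ∈ used → enum used (compress i) ≡ i
    enum-compress {i} h with i ∈? used
    ... | yes h′ = enum-index used h′
    ... | no ¬h  = contradiction h ¬h

    compress-enum : ∀ p → compress (enum used p) ≡ p
    compress-enum p = enum-injective used (enum-compress (enum-∈ used p))

    part : V G → Fin ∣ used ∣
    part v = compress (label v)

    enum-part : ∀ {v} → v ∈ H → enum used (part v) ≡ label v
    enum-part v∈H = enum-compress (label-used v∈H)

    representative : ∀ p → ∃ λ v → v ∈ H × part v ≡ p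
    representative p with ∈-toSubset⁻ _ (enum-∈ used p)
    ... | v , v∈H , eq = v , v∈H , trans (cong compress eq) (compress-enum p)

    bag : Fin (List.length bags) → Subset ∣ used ∣
    bag j = preimage (enum used) (List.lookup bags j)

    ∈-bag⁺ : ∀ {v} j → v ∈ H → label v ∈ List.lookup bags j → part v ∈ bag j
    ∈-bag⁺ j v∈H h = ∈-preimage⁺ (subst (_∈ _) (sym (enum-part v∈H)) h)

    ∈-bag⁻ : ∀ {v} j → v ∈ H → part v ∈ bag j → label v ∈ List.lookup bags j
    ∈-bag⁻ j v∈H h = subst (_∈ _) (enum-part v∈H) (∈-preimage⁻ h)

    located : ∀ {P : Subset N → Set} → Any P bags → ∃ λ j → P (List.lookup bags j)
    located found = Any.index found , Any.lookup-index found

    part-width : ∀ p → ∣ Part H part p ∣ ≤ k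
    part-width p with representative p
    ... | v , v∈H , refl = ℕ.≤-trans (p⊆q⇒∣p∣≤∣q∣ part⊆class) (class-width v v∈H)
      where
      part⊆class : Part H part (part v) ⊆ Part H label (label v)
      part⊆class h with ∈-Part⁻ {H = H} {part = part} h
      ... | u∈H , same = ∈-Part⁺ {part = label} u∈H
                           (trans (sym (enum-part u∈H)) (trans (cong (enum used) same) (enum-part v∈H)))

    part-cover : ∀ p → ∃ λ j → p ∈ bag j
    part-cover p with representative p
    ... | v , v∈H , refl = let (j , h) = located (bag-cover v v∈H) in j , ∈-bag⁺ j v∈H h

    part-edge : ∀ p q → p ≢ q →
      (∃ λ u → ∃ λ v → u ∈ H × v ∈ H × part u ≡ p × part v ≡ q × E G u v) →
      ∃ λ j → p ∈ bag j × q ∈ bag j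
    part-edge _ _ p≢q (u , v , u∈H , v∈H , refl , refl , e) =
      let (j , hu , hv) = located (bag-edge u v u∈H v∈H (λ eq → p≢q (cong compress eq)) e) in
      j , ∈-bag⁺ j u∈H hu , ∈-bag⁺ j v∈H hv

    part-path : ∀ p → Convex (λ j → p ∈ bag j)
    part-path p with representative p
    ... | v , v∈H , refl =
      convex-⇔ (λ j → ∈-bag⁺ j v∈H) (λ j → ∈-bag⁻ j v∈H) (contiguous⇒convex (bag-contiguous v v∈H))

    part-comp : ∀ C → Component G (λ v → Everything G v × v ∉ H) C →
      ∃ λ j → ∀ c v → c ∈ C → Everything G v → v ∉ C → E G c v → v ∈ H × part v ∈ bag j
    part-comp C C-comp = let (j , neighbours) = located (bag-comp C C-comp) in
      j , λ c v c∈C _ v∉C e → let (v∈H , h) = neighbours c v c∈C v∉C e in v∈H , ∈-bag⁺ j v∈H h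

    decomposition : PPD k G (Everything G) S
    decomposition = record
      { H             = H
      ; H⊆U           = λ _ _ → tt
      ; S⊆H           = S⊆H
      ; m             = ∣ used ∣
      ; part          = part
      ; part-nonempty = representative
      ; part-width    = part-width
      ; ℓ             = List.length bags
      ; bag           = bag
      ; bag-cover     = part-cover
      ; bag-edge      = part-edge
      ; bag-path      = part-path
      ; comp          = part-comp
      }

  compact : Σ (PPD k G (Everything G) S) (λ d → Width≤ d w × Rooted d r)
  compact = decomposition ,
    (λ j → ℕ.≤-trans (∣preimage∣≤ (enum-injective used)) (All.lookup bag-width (∈ₗ.∈-lookup j))) ,
    root∈H ,
    (λ v v∈H eq → root-alone v v∈H
       (trans (sym (enum-part v∈H)) (trans (cong (enum used) eq) (enum-part root∈H)))) ,
    (zero , refl , ∈-bag⁺ zero root∈H root-first)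

module _ {k G U S} (d : PPD k G U S) where

  witness : Fin (PPD.m d) → V G
  witness p = proj₁ (PPD.part-nonempty d p)

  witness-∈ : ∀ p → witness p ∈ PPD.H d
  witness-∈ p = proj₁ (proj₂ (PPD.part-nonempty d p))

  part-witness : ∀ p → PPD.part d (witness p) ≡ p
  part-witness p = proj₂ (proj₂ (PPD.part-nonempty d p))

  witness-injective : ∀ {p q} → witness p ≡ witness q → p ≡ q
  witness-injective {p} {q} eq = trans (sym (part-witness p)) (trans (cong (PPD.part d) eq) (part-witness q))

single-vertex-draft : ∀ {k w G S r} → 1 ≤ k → (∀ v → v ≡ r) → Draft k w G S r
single-vertex-draft {k} {w} {G} {S} {r} 1≤k all-r = record
  { N              = 1
  ; H              = ⊤
  ; S⊆H            = λ _ _ → ∈⊤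
  ; label          = λ _ → zero
  ; class-width    = λ _ _ → ℕ.≤-trans (p⊆q⇒∣p∣≤∣q∣ class⊆⁅r⁆) (subst (_≤ k) (sym (∣⁅x⁆∣≡1 r)) 1≤k)
  ; firstBag       = ⊤
  ; laterBags      = []
  ; bag-width      = s≤s z≤n ∷ []
  ; bag-cover      = λ _ _ → here ∈⊤
  ; bag-edge       = λ _ _ _ _ ne _ → contradiction refl ne
  ; bag-contiguous = λ _ _ → start (∈⊤ ∷ stop [])
  ; bag-comp       = λ C C-comp → let (c , c∈C) = proj₁ (proj₁ (proj₂ C-comp)) in
                       contradiction ∈⊤ (proj₂ (proj₁ C-comp c c∈C))
  ; root∈H         = ∈⊤
  ; root-alone     = λ v _ _ → all-r v
  ; root-first     = ∈⊤
  }
  where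
  class⊆⁅r⁆ : ∀ {v} → v ∈ Part {m = 1} ⊤ (λ _ → zero) zero → v ∈ ⁅ r ⁆
  class⊆⁅r⁆ {v} _ = subst (_∈ ⁅ r ⁆) (sym (all-r v)) (x∈⁅x⁆ r)

-- The components of G − X − r inside A are named by a representative vertex
-- chosen from the component alone, so that each is decomposed exactly once.

module Blocks (G : Graph) (r : V G) (X : Subset (Graph.n G)) (r∉X : r ∉ X) where

  abstract
    A : Subset (Graph.n G)
    A = reach G (∁ X) r

    r∈A : r ∈ A
    r∈A = Reach.reach⁺ G (∁ X) r (here (x∉p⇒x∈∁p r∉X))

    walk-to-A : ∀ {v} → v ∈ A → WalkIn G A r v
    walk-to-A = Reach.reach-walk G (∁ X) r

    walk-avoiding-X : ∀ {v} → v ∈ A → WalkIn G (∁ X) r v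
    walk-avoiding-X = Reach.reach⁻ G (∁ X) r

    walk-avoiding-X⇒∈A : ∀ {v} → WalkIn G (∁ X) r v → v ∈ A
    walk-avoiding-X⇒∈A = Reach.reach⁺ G (∁ X) r

    A-closed : ∀ {u v} → u ∈ A → v ∉ X → E G u v → v ∈ A
    A-closed u∈A v∉X e = Reach.reach-closed G (∁ X) r _ _ u∈A (x∉p⇒x∈∁p v∉X) e

  ∈A⇒∉X : ∀ {v} → v ∈ A → v ∉ X
  ∈A⇒∉X h = x∈∁p⇒x∉p (walk-target (walk-avoiding-X h))

  leaving-A : ∀ {u v} → u ∈ A → v ∉ A → E G u v → v ∈ X
  leaving-A {v = v} u∈A v∉A e with v ∈? X
  ... | yes v∈X = v∈X
  ... | no v∉X  = contradiction (A-closed u∈A v∉X e) v∉A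

  Inner : V G → Set
  Inner v = v ∈ A × v ≢ r

  inner? : Decidable Inner
  inner? v = (v ∈? A) ×-dec ¬? (v ≟ r)

  G−X−r : V G → Set
  G−X−r v = v ∉ X × v ≢ r

  G−X−r? : Decidable G−X−r
  G−X−r? v = ¬? (v ∈? X) ×-dec ¬? (v ≟ r)

  inner⇒G−X−r : ∀ {v} → Inner v → G−X−r v
  inner⇒G−X−r (v∈A , v≢r) = ∈A⇒∉X v∈A , v≢r

  abstract
    comp : V G → Subset (Graph.n G)
    comp = reach G (toSubset G−X−r?)

    comp⁺ : ∀ {u v} → WalkIn G (toSubset G−X−r?) u v → v ∈ comp u
    comp⁺ {u} = Reach.reach⁺ G (toSubset G−X−r?) u

    comp⁻ : ∀ {u v} → v ∈ comp u → WalkIn G (toSubset G−X−r?) u v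
    comp⁻ {u} = Reach.reach⁻ G (toSubset G−X−r?) u

    comp-step : ∀ {u w v} → w ∈ comp u → G−X−r v → E G w v → v ∈ comp u
    comp-step {u} w∈ ∉Xr e = Reach.reach-closed G (toSubset G−X−r?) u _ _ w∈ (∈-toSubset⁺ _ ∉Xr) e

    comp-component : ∀ {u} → G−X−r u → Component G G−X−r (comp u)
    comp-component ∉Xr = reach-component G−X−r (λ _ → ∈-toSubset⁻ _) (λ _ → ∈-toSubset⁺ _) (∈-toSubset⁺ _ ∉Xr)

  comp-self : ∀ {u} → G−X−r u → u ∈ comp u
  comp-self ∉Xr = comp⁺ (here (∈-toSubset⁺ _ ∉Xr))

  comp-sym : ∀ {u w} → w ∈ comp u → u ∈ comp w
  comp-sym h = comp⁺ (walk-reverse (comp⁻ h))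

  comp-trans : ∀ {u w v} → w ∈ comp u → v ∈ comp w → v ∈ comp u
  comp-trans h h′ = comp⁺ (comp⁻ h ++ʷ comp⁻ h′)

  comp⊆G−X−r : ∀ {u v} → v ∈ comp u → G−X−r v
  comp⊆G−X−r h = ∈-toSubset⁻ _ (walk-target (comp⁻ h))

  comp-inner : ∀ {u v} → Inner u → v ∈ comp u → Inner v
  comp-inner (u∈A , _) h =
    closed-walk (λ _ _ w∈A v∉X e → A-closed w∈A (x∈∁p⇒x∉p v∉X) e) u∈A
      (walk-mono (λ h → x∉p⇒x∈∁p (proj₁ (∈-toSubset⁻ _ h))) (comp⁻ h)) ,
    proj₂ (comp⊆G−X−r h)

  comp-≡ : ∀ {u v} → v ∈ comp u → comp v ≡ comp u
  comp-≡ h = ⊆-antisym (comp-trans h) (comp-trans (comp-sym h))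

  abstract
    rep : V G → V G
    rep v = pick (comp v) v

    rep-∈ : ∀ {v} → G−X−r v → rep v ∈ comp v
    rep-∈ ∉Xr = pick-∈ _ (comp-self ∉Xr)

    rep-cong : ∀ {u v} → G−X−r u → v ∈ comp u → rep v ≡ rep u
    rep-cong {u} {v} ∉Xr h =
      trans (cong (λ p → pick p v) (comp-≡ h)) (pick-default-irrelevant v u (comp-self ∉Xr))

    -- the truth of a Boolean, so that any two proofs of IsRep u are equal
    IsRep : V G → Set
    IsRep u = True (inner? u ×-dec (rep u ≟ u))

    isRep? : ∀ u → Dec (IsRep u)
    isRep? u = T? _

    IsRep-irrelevant : ∀ {u} (ρ ρ′ : IsRep u) → ρ ≡ ρ′
    IsRep-irrelevant = T-irrelevant

    rep⇒inner : ∀ {u} → IsRep u → Inner u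
    rep⇒inner ρ = proj₁ (toWitness ρ)

    rep-self : ∀ {u} → IsRep u → rep u ≡ u
    rep-self ρ = proj₂ (toWitness ρ)

    rep-isRep : ∀ {v} → Inner v → IsRep (rep v)
    rep-isRep i = fromWitness (comp-inner i (rep-∈ (inner⇒G−X−r i)) ,
                               rep-cong (inner⇒G−X−r i) (rep-∈ (inner⇒G−X−r i)))

  rep-of-member : ∀ {u v} → IsRep u → v ∈ comp u → rep v ≡ u
  rep-of-member ρ h = trans (rep-cong (inner⇒G−X−r (rep⇒inner ρ)) h) (rep-self ρ)

  member-of-rep : ∀ {v} → Inner v → v ∈ comp (rep v)
  member-of-rep i = comp-sym (rep-∈ (inner⇒G−X−r i))

  reps-equal : ∀ {u u′ v} → IsRep u → IsRep u′ → v ∈ comp u → v ∈ comp u′ → u ≡ u′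
  reps-equal ρ ρ′ h h′ = trans (sym (rep-of-member ρ h)) (rep-of-member ρ′ h′)

  private
    exit : ∀ {u} → G−X−r u → WalkIn G (∁ X) u r → ∃ λ w → w ∈ comp u × E G r w
    exit (_ , u≢r) (here _) = contradiction refl u≢r
    exit {u} ∉Xr (step {w = w} _ e p) with w ≟ r
    ... | yes refl = u , comp-self ∉Xr , E-sym {G} e
    ... | no w≢r with exit (x∈∁p⇒x∉p (walk-source p) , w≢r) p
    ...   | w′ , h , e′ =
      w′ , comp-trans (comp-step (comp-self ∉Xr) (x∈∁p⇒x∉p (walk-source p) , w≢r) e) h , e′

  comp-touches-root : ∀ {u} → Inner u → ∃ λ w → w ∈ comp u × E G r w
  comp-touches-root i@(u∈A , _) = exit (inner⇒G−X−r i) (walk-reverse (walk-avoiding-X u∈A))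

module Collapse (G : Graph) (r : V G) (X : Subset (Graph.n G)) (r∉X : r ∉ X)
  (paths : ∀ v → v ∈ X → PathAvoiding G X r v) where

  open Blocks G r X r∉X

  abstract
    K : Subset (Graph.n G)
    K = toSubset (λ v → (v ≟ r) ⊎-dec (¬? (v ∈? A) ×-dec ¬? (v ∈? X)))

    outer∈K : ∀ {v} → v ∉ A → v ∉ X → v ∈ K
    outer∈K v∉A v∉X = ∈-toSubset⁺ _ (inj₂ (v∉A , v∉X))

    ∈K⇒root-or-outer : ∀ {v} → v ∈ K → v ≡ r ⊎ (v ∉ A × v ∉ X)
    ∈K⇒root-or-outer = ∈-toSubset⁻ _

    r∈K : r ∈ K
    r∈K = ∈-toSubset⁺ _ (inj₁ refl)

    r′ : Fin ∣ K ∣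
    r′ = index K r∈K

    κ : V G → Fin ∣ K ∣
    κ v with v ∈? K
    ... | yes h = index K h
    ... | no _  = r′

    enum-κ : ∀ {v} → v ∈ K → enum K (κ v) ≡ v
    enum-κ {v} h with v ∈? K
    ... | yes h′ = enum-index K h′
    ... | no ¬h  = contradiction h ¬h

    κ∉K : ∀ {v} → v ∉ K → κ v ≡ r′
    κ∉K {v} h with v ∈? K
    ... | yes h′ = contradiction h′ h
    ... | no _   = refl

    κ-root : κ r ≡ r′
    κ-root = enum-injective K (trans (enum-κ r∈K) (sym (enum-index K r∈K)))

  κ-enum : ∀ a → κ (enum K a) ≡ a
  κ-enum a = enum-injective K (enum-κ (enum-∈ K a))

  κ≢r′⇒∈K : ∀ {v} → κ v ≢ r′ → v ∈ K
  κ≢r′⇒∈K {v} ne with v ∈? K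
  ... | yes h = h
  ... | no h  = contradiction (κ∉K h) ne

  κ-injective : ∀ {u v} → κ u ≡ κ v → κ u ≢ r′ → u ≡ v
  κ-injective {u} {v} eq ne = trans (sym (enum-κ (κ≢r′⇒∈K ne)))
    (trans (cong (enum K) eq) (enum-κ (κ≢r′⇒∈K (λ e → ne (trans eq e)))))

  κ≡r′⁺ : ∀ {v} → v ∈ A ⊎ v ∈ X → κ v ≡ r′
  κ≡r′⁺ {v} h with v ∈? K
  ... | no v∉K = κ∉K v∉K
  ... | yes v∈K with ∈K⇒root-or-outer v∈K | h
  ...   | inj₁ refl         | _        = κ-root
  ...   | inj₂ (v∉A , _)    | inj₁ v∈A = contradiction v∈A v∉A
  ...   | inj₂ (_ , v∉X)    | inj₂ v∈X = contradiction v∈X v∉X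

  κ≡r′⁻ : ∀ {v} → κ v ≡ r′ → v ∈ A ⊎ v ∈ X
  κ≡r′⁻ {v} eq with v ∈? A | v ∈? X
  ... | yes v∈A | _       = inj₁ v∈A
  ... | no _    | yes v∈X = inj₂ v∈X
  ... | no v∉A  | no v∉X  = contradiction (subst (_∈ A) (sym v≡r) r∈A) v∉A
    where
    v≡r : v ≡ r
    v≡r = trans (sym (enum-κ (outer∈K v∉A v∉X)))
                (trans (cong (enum K) (trans eq (sym κ-root))) (enum-κ r∈K))

  open Contraction G κ public
    using (fiber; ∈-fiber⁺; ∈-fiber⁻; quotient; E-quotient⁺)

  private
    A⊆fiber : ∀ {v} → v ∈ A → v ∈ fiber r′
    A⊆fiber h = ∈-fiber⁺ (κ≡r′⁺ (inj₁ h))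

    path-walk : ∀ {a v} inner → a ∈ A → Linked (E G) (a ∷ inner ++ [ v ]) → All (_∉ X) inner →
                v ∈ fiber r′ → WalkIn G (fiber r′) a v
    path-walk []       a∈A (e ∷ [-])  []           v∈ = step (A⊆fiber a∈A) e (here v∈)
    path-walk (b ∷ bs) a∈A (e ∷ link) (b∉X ∷ bs∉X) v∈ =
      step (A⊆fiber a∈A) e (path-walk bs (A-closed a∈A b∉X e) link bs∉X v∈)

    walk-from-root : ∀ {v} → v ∈ fiber r′ → WalkIn G (fiber r′) r v
    walk-from-root {v} h with κ≡r′⁻ (∈-fiber⁻ h)
    ... | inj₁ v∈A = walk-mono A⊆fiber (walk-to-A v∈A)
    ... | inj₂ v∈X with paths v v∈X
    ...   | inner , linked , _ , avoids = path-walk inner r∈A linked avoids h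

  fiber-connected : ∀ a → Connected G (fiber a)
  fiber-connected a with a ≟ r′
  ... | yes refl = (r , ∈-fiber⁺ κ-root) , λ u v hu hv →
                     walk-reverse (walk-from-root hu) ++ʷ walk-from-root hv
  ... | no a≢r′  = (enum K a , ∈-fiber⁺ (κ-enum a)) , λ u v hu hv →
                     subst (WalkIn G (fiber a) u)
                       (κ-injective (trans (∈-fiber⁻ hu) (sym (∈-fiber⁻ hv)))
                                    (λ e → a≢r′ (trans (sym (∈-fiber⁻ hu)) e)))
                       (here hu)

  outer-κ≢r′ : ∀ {v} → v ∉ A → v ∉ X → κ v ≢ r′
  outer-κ≢r′ v∉A v∉X eq with κ≡r′⁻ eq
  ... | inj₁ v∈A = v∉A v∈A
  ... | inj₂ v∈X = v∉X v∈X

  G′ : Graph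
  G′ = quotient

  component-image : ∀ {U′ : VPred G′} {C} → Component G (λ v → U′ (κ v)) C → Component G′ U′ (image κ C)
  component-image = Contraction.component-image G κ fiber-connected

  model : Model G′ G
  model = Contraction.fiberModel G κ fiber-connected

  r∈branch : r ∈ Model.branch model r′
  r∈branch = ∈-fiber⁺ κ-root

  G′-smaller : ∀ {v} → v ∉ K → Graph.n G′ < Graph.n G
  G′-smaller = ∉⇒∣p∣<n

  -- If nothing is contracted then X is empty and A = {r}.
  nothing-contracted : Connected G ⊤ → (∀ v → v ∈ K) → ∀ v → v ≡ r
  nothing-contracted (_ , walk) kept v with ∈K⇒root-or-outer (kept v)
  ... | inj₁ v≡r        = v≡r
  ... | inj₂ (v∉A , _) = contradiction (walk-avoiding-X⇒∈A (walk-mono avoids-X (walk r v ∈⊤ ∈⊤))) v∉A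
    where
    avoids-X : ∀ {w} → w ∈ ⊤ → w ∈ ∁ X
    avoids-X {w} _ = x∉p⇒x∈∁p λ w∈X → [ (λ w≡r → r∉X (subst (_∈ X) w≡r w∈X)) , (λ (_ , w∉X) → w∉X w∈X) ]′
                                          (∈K⇒root-or-outer (kept w))

module Glue
  (G : Graph) (S : VPred G) (x y : ℕ) (r : V G) (X : Subset (Graph.n G)) (r∉X : r ∉ X)
  (1≤x : 1 ≤ x) (∣X∣≤x : ∣ X ∣ ≤ x)
  (paths : ∀ v → v ∈ X → PathAvoiding G X r v)
  (decompose : ∀ C → Component G (λ v → v ∉ X × v ≢ r) C → (∃ λ u → u ∈ C × E G r u) →
               Σ (PPD x G (λ v → v ∈ C) (λ v → S v × v ∈ C)) (λ d → Width≤ d y))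
  where

  open Blocks G r X r∉X
  open Collapse G r X r∉X paths

  data Zone (v : V G) : Set where
    root    : v ≡ r → Zone v
    inner   : Inner v → Zone v
    outside : v ∉ A → Zone v

  zone : ∀ v → Zone v
  zone v = classify (v ≟ r) (v ∈? A)
    where
    classify : Dec (v ≡ r) → Dec (v ∈ A) → Zone v
    classify (yes v≡r) _         = root v≡r
    classify (no v≢r)  (yes v∈A) = inner (v∈A , v≢r)
    classify (no _)    (no v∉A)  = outside v∉A

  module _
    (d′ : PPD x G′ (Everything G′) (ImageSet model S))
    (d′-width : Width≤ d′ (y + 2))
    (d′-rooted : Rooted d′ r′)
    where

    private
      module D′ = PPD d′
      n  = Graph.n G
      m′ = D′.m

    N : ℕ
    N = n + m′

    abstract
      decomposeBlock : ∀ {u} → IsRep u →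
        Σ (PPD x G (_∈ comp u) (λ v → S v × v ∈ comp u)) (λ d → Width≤ d y)
      decomposeBlock {u} ρ =
        decompose (comp u) (comp-component (inner⇒G−X−r (rep⇒inner ρ))) (comp-touches-root (rep⇒inner ρ))

    block : ∀ {u} → IsRep u → PPD x G (_∈ comp u) (λ v → S v × v ∈ comp u)
    block ρ = proj₁ (decomposeBlock ρ)

    block-width : ∀ {u} (ρ : IsRep u) → Width≤ (block ρ) y
    block-width ρ = proj₂ (decomposeBlock ρ)

    -- A part of a component's decomposition is labelled by its witness w as
    -- w ↑ˡ m′, the part {r} as r ↑ˡ m′, and a part p of d′ as n ↑ʳ p; the part
    -- X takes over the label of {r′}.

    rootLabel : Fin N
    rootLabel = r ↑ˡ m′

    blockLabel : ∀ {u} (ρ : IsRep u) → Fin (PPD.m (block ρ)) → Fin N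
    blockLabel ρ p = witness (block ρ) p ↑ˡ m′

    outLabel : Fin m′ → Fin N
    outLabel p = n ↑ʳ p

    core : Subset N
    core = ⁅ rootLabel ⁆ ∪ ⁅ outLabel (D′.part r′) ⁆

    labelIn : ∀ v → Zone v → Fin N
    labelIn v (root _)    = rootLabel
    labelIn v (inner i)   = blockLabel (rep-isRep i) (PPD.part (block (rep-isRep i)) v)
    labelIn v (outside _) = outLabel (D′.part (κ v))

    InH : ∀ v → Zone v → Set
    InH v (root _)    = Unit
    InH v (inner i)   = v ∈ PPD.H (block (rep-isRep i))
    InH v (outside _) = κ v ∈ D′.H

    inH? : ∀ v z → Dec (InH v z)
    inH? v (root _)    = yes tt
    inH? v (inner i)   = v ∈? PPD.H (block (rep-isRep i))
    inH? v (outside _) = κ v ∈? D′.H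

    label : V G → Fin N
    label v = labelIn v (zone v)

    H : Subset n
    H = toSubset (λ v → inH? v (zone v))

    private
      zone-agree : ∀ {v} (z z′ : Zone v) → labelIn v z ≡ labelIn v z′ × (InH v z → InH v z′)
      zone-agree (root _)    (root _)    = refl , λ h → h
      zone-agree {v} (inner i) (inner i′) =
        cong (λ ρ → blockLabel {rep v} ρ (PPD.part (block ρ) v)) (IsRep-irrelevant _ _) ,
        subst (λ ρ → v ∈ PPD.H (block {rep v} ρ)) (IsRep-irrelevant _ _)
      zone-agree (outside _) (outside _) = refl , λ h → h
      zone-agree (root refl) (inner (_ , r≢r))   = contradiction refl r≢r
      zone-agree (root refl) (outside r∉A)       = contradiction r∈A r∉A
      zone-agree (inner (_ , r≢r)) (root refl)   = contradiction refl r≢r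
      zone-agree (inner (v∈A , _)) (outside v∉A) = contradiction v∈A v∉A
      zone-agree (outside r∉A) (root refl)       = contradiction r∈A r∉A
      zone-agree (outside v∉A) (inner (v∈A , _)) = contradiction v∈A v∉A

    label≡ : ∀ {v} (z : Zone v) → label v ≡ labelIn v z
    label≡ z = proj₁ (zone-agree (zone _) z)

    ∈H⁺ : ∀ {v} (z : Zone v) → InH v z → v ∈ H
    ∈H⁺ z h = ∈-toSubset⁺ _ (proj₂ (zone-agree z (zone _)) h)

    ∈H⁻ : ∀ {v} (z : Zone v) → v ∈ H → InH v z
    ∈H⁻ z h = proj₂ (zone-agree (zone _) z) (∈-toSubset⁻ _ h)

    private
      relabel : ∀ {w u u′} → u ≡ u′ → (ρ : IsRep u) (ρ′ : IsRep u′) →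
        blockLabel ρ (PPD.part (block ρ) w) ≡ blockLabel ρ′ (PPD.part (block ρ′) w) ×
        (w ∈ PPD.H (block ρ) → w ∈ PPD.H (block ρ′))
      relabel {w} {u} refl ρ ρ′ =
        cong (λ σ → blockLabel {u} σ (PPD.part (block σ) w)) (IsRep-irrelevant ρ ρ′) ,
        subst (λ σ → w ∈ PPD.H (block {u} σ)) (IsRep-irrelevant ρ ρ′)

    module _ {u} (ρ : IsRep u) where

      private
        d = block ρ

      label-block : ∀ {w} → w ∈ comp u → label w ≡ blockLabel ρ (PPD.part d w)
      label-block h = trans (label≡ (inner (comp-inner (rep⇒inner ρ) h)))
                            (proj₁ (relabel (rep-of-member ρ h) _ ρ))

      ∈H⇒∈block : ∀ {w} → w ∈ comp u → w ∈ H → w ∈ PPD.H d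
      ∈H⇒∈block h w∈H = proj₂ (relabel (rep-of-member ρ h) _ ρ) (∈H⁻ (inner (comp-inner (rep⇒inner ρ) h)) w∈H)

      ∈block⇒∈H : ∀ {w} → w ∈ PPD.H d → w ∈ H
      ∈block⇒∈H {w} w∈d = ∈H⁺ (inner i)
        (proj₂ (relabel (sym (rep-of-member ρ w∈comp)) ρ (rep-isRep i)) w∈d)
        where
        w∈comp = PPD.H⊆U d w w∈d
        i = comp-inner (rep⇒inner ρ) w∈comp

      witness-∈comp : ∀ p → witness d p ∈ comp u
      witness-∈comp p = PPD.H⊆U d _ (witness-∈ d p)

      blockLabel-injective : ∀ {p q} → blockLabel ρ p ≡ blockLabel ρ q → p ≡ q
      blockLabel-injective eq = witness-injective d (Fin.↑ˡ-injective m′ _ _ eq)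

      blockLabel≢rootLabel : ∀ {p} → blockLabel ρ p ≢ rootLabel
      blockLabel≢rootLabel {p} eq =
        proj₂ (comp⊆G−X−r (subst (_∈ comp u) (Fin.↑ˡ-injective m′ _ _ eq) (witness-∈comp p))) refl

      blockLabel≢outLabel : ∀ {p q} → blockLabel ρ p ≢ outLabel q
      blockLabel≢outLabel = ↑ˡ≢↑ʳ _ _

      blockLabel∉core : ∀ {p} → blockLabel ρ p ∉ core
      blockLabel∉core h with x∈p∪q⁻ _ _ h
      ... | inj₁ h′ = blockLabel≢rootLabel (x∈⁅y⁆⇒x≡y _ h′)
      ... | inj₂ h′ = blockLabel≢outLabel (x∈⁅y⁆⇒x≡y _ h′)

    blockLabel-separates : ∀ {u u′} (ρ : IsRep u) (ρ′ : IsRep u′) {p q} →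
      blockLabel ρ p ≡ blockLabel ρ′ q → u ≡ u′
    blockLabel-separates ρ ρ′ {p} eq =
      reps-equal ρ ρ′ (witness-∈comp ρ p)
        (subst (_∈ comp _) (sym (Fin.↑ˡ-injective m′ _ _ eq)) (witness-∈comp ρ′ _))

    private
      r′∈H′ : r′ ∈ D′.H
      r′∈H′ = proj₁ d′-rooted

      r′-alone : ∀ {a} → a ∈ D′.H → D′.part a ≡ D′.part r′ → a ≡ r′
      r′-alone = proj₁ (proj₂ d′-rooted) _

      r′-first : ∃ λ j → toℕ j ≡ 0 × D′.part r′ ∈ D′.bag j
      r′-first = proj₂ (proj₂ d′-rooted)

      root⁻ : ∀ {w} (z : Zone w) → labelIn w z ≡ rootLabel → w ≡ r
      root⁻ (root w≡r)  _  = w≡r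
      root⁻ (inner i)   eq = contradiction eq (blockLabel≢rootLabel (rep-isRep i))
      root⁻ (outside _) eq = contradiction (sym eq) (↑ˡ≢↑ʳ _ _)

      block⁻ : ∀ {w u} (ρ : IsRep u) {p} (z : Zone w) → labelIn w z ≡ blockLabel ρ p → w ∈ comp u
      block⁻ ρ (root _)    eq = contradiction (sym eq) (blockLabel≢rootLabel ρ)
      block⁻ ρ (inner i)   eq =
        subst (λ u → _ ∈ comp u) (blockLabel-separates (rep-isRep i) ρ eq) (member-of-rep i)
      block⁻ ρ (outside _) eq = contradiction (sym eq) (blockLabel≢outLabel ρ)

      out⁻ : ∀ {w p} (z : Zone w) → labelIn w z ≡ outLabel p → w ∉ A × D′.part (κ w) ≡ p
      out⁻ (root _)      eq = contradiction eq (↑ˡ≢↑ʳ _ _)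
      out⁻ (inner i)     eq = contradiction eq (blockLabel≢outLabel (rep-isRep i))
      out⁻ (outside w∉A) eq = w∉A , Fin.↑ʳ-injective n _ _ eq

    label-root⁻ : ∀ {w} → label w ≡ rootLabel → w ≡ r
    label-root⁻ = root⁻ (zone _)

    label-block⁻ : ∀ {w u} (ρ : IsRep u) {p} → label w ≡ blockLabel ρ p →
      w ∈ comp u × PPD.part (block ρ) w ≡ p
    label-block⁻ ρ eq = w∈comp , blockLabel-injective ρ (trans (sym (label-block ρ w∈comp)) eq)
      where w∈comp = block⁻ ρ (zone _) eq

    label-out⁻ : ∀ {w p} → label w ≡ outLabel p → w ∉ A × D′.part (κ w) ≡ p
    label-out⁻ = out⁻ (zone _)

    private
      class⁻ : ∀ {w i} → w ∈ Part H label i → w ∈ H × label w ≡ i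
      class⁻ = ∈-Part⁻ {H = H} {part = label}

      root-class : Part H label rootLabel ⊆ ⁅ r ⁆
      root-class h = subst (_∈ ⁅ r ⁆) (sym (label-root⁻ (proj₂ (class⁻ h)))) (x∈⁅x⁆ r)

      block-class : ∀ {u} (ρ : IsRep u) p →
        Part H label (blockLabel ρ p) ⊆ Part (PPD.H (block ρ)) (PPD.part (block ρ)) p
      block-class ρ p h with class⁻ h
      ... | w∈H , eq with label-block⁻ ρ eq
      ...   | w∈comp , same = ∈-Part⁺ {part = PPD.part (block ρ)} (∈H⇒∈block ρ w∈comp w∈H) same

      out-class : ∀ {w p} → w ∈ Part H label (outLabel p) → w ∉ A × κ w ∈ D′.H × D′.part (κ w) ≡ p
      out-class h with class⁻ h
      ... | w∈H , eq with label-out⁻ eq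
      ...   | w∉A , same = w∉A , ∈H⁻ (outside w∉A) w∈H , same

      X-class : Part H label (outLabel (D′.part r′)) ⊆ X
      X-class h with out-class h
      ... | w∉A , κw∈H′ , same with κ≡r′⁻ (r′-alone κw∈H′ same)
      ...   | inj₁ w∈A = contradiction w∈A w∉A
      ...   | inj₂ w∈X = w∈X

      outer-class-width : ∀ {a} → a ∈ D′.H → a ≢ r′ →
        ∣ Part H label (outLabel (D′.part a)) ∣ ≤ ∣ Part D′.H D′.part (D′.part a) ∣
      outer-class-width {a} a∈H′ a≢r′ = injection⇒∣p∣≤∣q∣ (λ w _ → κ w)
        (λ w h → let (_ , κw∈H′ , same) = out-class h in ∈-Part⁺ {part = D′.part} κw∈H′ same)
        (λ w w′ h _ eq → κ-injective eq λ κw≡r′ →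
           a≢r′ (r′-alone a∈H′ (trans (sym (proj₂ (proj₂ (out-class h)))) (cong D′.part κw≡r′))))

      class-width-in : ∀ {v} (z : Zone v) → v ∈ H → ∣ Part H label (labelIn v z) ∣ ≤ x
      class-width-in (root _) _ =
        ℕ.≤-trans (p⊆q⇒∣p∣≤∣q∣ root-class) (subst (_≤ x) (sym (∣⁅x⁆∣≡1 r)) 1≤x)
      class-width-in {v} (inner i) _ =
        ℕ.≤-trans (p⊆q⇒∣p∣≤∣q∣ (block-class ρ _)) (PPD.part-width (block ρ) (PPD.part (block ρ) v))
        where ρ = rep-isRep i
      class-width-in {v} (outside v∉A) v∈H = by-root (κ v ≟ r′)
        where
        by-root : Dec (κ v ≡ r′) → ∣ Part H label (outLabel (D′.part (κ v))) ∣ ≤ x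
        by-root (yes κv≡r′) = ℕ.≤-trans (p⊆q⇒∣p∣≤∣q∣ (subst (λ a → Part H label (outLabel (D′.part a)) ⊆ X)
                                                        (sym κv≡r′) X-class)) ∣X∣≤x
        by-root (no κv≢r′)  = ℕ.≤-trans (outer-class-width (∈H⁻ (outside v∉A) v∈H) κv≢r′)
                                         (D′.part-width (D′.part (κ v)))

    class-width : ∀ v → v ∈ H → ∣ Part H label (label v) ∣ ≤ x
    class-width v = class-width-in (zone v)

    blockBag : ∀ {u} (ρ : IsRep u) → Fin (PPD.ℓ (block ρ)) → Subset N
    blockBag ρ q = core ∪ image (blockLabel ρ) (PPD.bag (block ρ) q)

    private
      bagsOf : ∀ {u} → Dec (IsRep u) → List (Subset N)
      bagsOf (yes ρ) = List.tabulate (blockBag ρ)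
      bagsOf (no _)  = []

    blockBags : V G → List (Subset N)
    blockBags u = bagsOf (isRep? u)

    tailBag : Fin D′.ℓ → Subset N
    tailBag j = image outLabel (D′.bag j)

    laterBags : List (Subset N)
    laterBags = concat (List.tabulate blockBags) ++ List.tabulate tailBag

    bags : List (Subset N)
    bags = core ∷ laterBags

    blockBags-rep : ∀ {u} (ρ : IsRep u) → blockBags u ≡ List.tabulate (blockBag ρ)
    blockBags-rep {u} ρ = from (isRep? u)
      where
      from : (ρ? : Dec (IsRep u)) → bagsOf ρ? ≡ List.tabulate (blockBag ρ)
      from (yes ρ′) = cong (λ σ → List.tabulate (blockBag {u} σ)) (IsRep-irrelevant ρ′ ρ)
      from (no ¬ρ)  = contradiction ρ ¬ρ

    blockBags-All : ∀ {P : Subset N → Set} u → (∀ (ρ : IsRep u) q → P (blockBag ρ q)) → All P (blockBags u)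
    blockBags-All {P} u f = from (isRep? u)
      where
      from : (ρ? : Dec (IsRep u)) → All P (bagsOf ρ?)
      from (yes ρ) = All.tabulate⁺ (f ρ)
      from (no _)  = []

    allBlocks-All : ∀ {P : Subset N → Set} → (∀ {u} (ρ : IsRep u) q → P (blockBag ρ q)) →
      All P (concat (List.tabulate blockBags))
    allBlocks-All f = All.concat⁺ (All.tabulate⁺ λ u → blockBags-All u f)

    inBlock : ∀ {P : Subset N → Set} {u} (ρ : IsRep u) q → P (blockBag ρ q) → Any P bags
    inBlock {P} {u} ρ q h = there (Any.++⁺ˡ (Any.concat⁺ (Any.tabulate⁺ u
      (subst (Any P) (sym (blockBags-rep ρ)) (Any.tabulate⁺ q h)))))

    inTail : ∀ {P : Subset N → Set} j → P (tailBag j) → Any P bags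
    inTail j h = there (Any.++⁺ʳ (concat (List.tabulate blockBags)) (Any.tabulate⁺ j h))

    rootLabel∈core : rootLabel ∈ core
    rootLabel∈core = x∈p∪q⁺ (inj₁ (x∈⁅x⁆ _))

    xLabel∈core : outLabel (D′.part r′) ∈ core
    xLabel∈core = x∈p∪q⁺ (inj₂ (x∈⁅x⁆ _))

    core⊆blockBag : ∀ {u} (ρ : IsRep u) q → core ⊆ blockBag ρ q
    core⊆blockBag ρ q h = x∈p∪q⁺ (inj₁ h)

    ∈blockBag : ∀ {u} (ρ : IsRep u) {q p} → p ∈ PPD.bag (block ρ) q → blockLabel ρ p ∈ blockBag ρ q
    ∈blockBag ρ h = x∈p∪q⁺ (inj₂ (∈-image⁺ h))

    label-outside : ∀ {v} → v ∉ A → label v ≡ outLabel (D′.part (κ v))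
    label-outside v∉A = label≡ (outside v∉A)

    label-root : label r ≡ rootLabel
    label-root = label≡ (root refl)

    label-X : ∀ {v} → v ∈ X → label v ≡ outLabel (D′.part r′)
    label-X v∈X =
      trans (label-outside (λ v∈A → ∈A⇒∉X v∈A v∈X)) (cong (outLabel ∘ D′.part) (κ≡r′⁺ (inj₂ v∈X)))

    bag-width : All (λ B → ∣ B ∣ ≤ suc (y + 2)) bags
    bag-width = ℕ.≤-trans core-width (ℕ.≤-trans (ℕ.m≤n+m 2 y) (ℕ.n≤1+n _)) ∷
                All.++⁺ (allBlocks-All block-bag-width)
                        (All.tabulate⁺ λ j → ℕ.≤-trans (∣image∣≤ {f = outLabel} {B = D′.bag j}) (d′-width j))
      where
      core-width : ∣ core ∣ ≤ 2
      core-width = ℕ.≤-trans (∣p∪q∣≤∣p∣+∣q∣ ⁅ rootLabel ⁆ ⁅ outLabel (D′.part r′) ⁆)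
                             (ℕ.≤-reflexive (cong₂ _+_ (∣⁅x⁆∣≡1 rootLabel) (∣⁅x⁆∣≡1 (outLabel (D′.part r′)))))
      block-bag-width : ∀ {u} (ρ : IsRep u) q → ∣ blockBag ρ q ∣ ≤ suc (y + 2)
      block-bag-width ρ q = ℕ.≤-trans (∣p∪q∣≤∣p∣+∣q∣ core (image (blockLabel ρ) (PPD.bag (block ρ) q)))
        (ℕ.≤-trans (ℕ.+-mono-≤ core-width
                     (ℕ.≤-trans (∣image∣≤ {f = blockLabel ρ} {B = PPD.bag (block ρ) q}) (block-width ρ q)))
                   (ℕ.≤-reflexive (ℕ.+-comm 2 (suc y))))

    private
      outLabel-injective : ∀ {p q} → outLabel p ≡ outLabel q → p ≡ q
      outLabel-injective = Fin.↑ʳ-injective n _ _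

      outLabel∉core : ∀ {p} → p ≢ D′.part r′ → outLabel p ∉ core
      outLabel∉core p≢ h with x∈p∪q⁻ _ _ h
      ... | inj₁ h′ = ↑ˡ≢↑ʳ _ _ (sym (x∈⁅y⁆⇒x≡y _ h′))
      ... | inj₂ h′ = p≢ (outLabel-injective (x∈⁅y⁆⇒x≡y _ h′))

      ∉tailBag : ∀ {i} → (∀ p → outLabel p ≢ i) → ∀ j → i ∉ tailBag j
      ∉tailBag ≢out j h = let (p , _ , eq) = ∈-image⁻ h in ≢out p eq

      ∉blockBag : ∀ {u} (ρ : IsRep u) {i} → i ∉ core → (∀ p → blockLabel ρ p ≢ i) → ∀ q → i ∉ blockBag ρ q
      ∉blockBag ρ i∉core ≢block q h with x∈p∪q⁻ _ _ h
      ... | inj₁ h′ = i∉core h′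
      ... | inj₂ h′ = let (p , _ , eq) = ∈-image⁻ h′ in ≢block p eq

      root∈H : r ∈ H
      root∈H = ∈H⁺ (root refl) tt

      X⊆H : ∀ {v} → v ∈ X → v ∈ H
      X⊆H v∈X = ∈H⁺ (outside (λ v∈A → ∈A⇒∉X v∈A v∈X)) (subst (_∈ D′.H) (sym (κ≡r′⁺ (inj₂ v∈X))) r′∈H′)

      label-r∈core : label r ∈ core
      label-r∈core = subst (_∈ core) (sym label-root) rootLabel∈core

      label-X∈core : ∀ {v} → v ∈ X → label v ∈ core
      label-X∈core v∈X = subst (_∈ core) (sym (label-X v∈X)) xLabel∈core

      attached : ∀ {v} → Dec (v ≡ r) → Dec (v ∈ X) → ¬ G−X−r v → v ∈ H × label v ∈ core
      attached (yes refl) _         _    = root∈H , label-r∈core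
      attached (no _)     (yes v∈X) _    = X⊆H v∈X , label-X∈core v∈X
      attached (no v≢r)   (no v∉X)  ¬G−X−r = contradiction (v∉X , v≢r) ¬G−X−r

    S⊆H : ∀ v → S v → v ∈ H
    S⊆H v s = in-zone (zone v)
      where
      in-zone : Zone v → v ∈ H
      in-zone z@(root _)    = ∈H⁺ z tt
      in-zone z@(inner i)   = ∈H⁺ z (PPD.S⊆H (block (rep-isRep i)) v (s , member-of-rep i))
      in-zone z@(outside _) = ∈H⁺ z (D′.S⊆H (κ v) (v , s , ∈-fiber⁺ refl))

    bag-cover : ∀ v → v ∈ H → Any (label v ∈_) bags
    bag-cover v _ = cover-in (zone v)
      where
      cover-in : (z : Zone v) → Any (labelIn v z ∈_) bags
      cover-in (root _)    = here rootLabel∈core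
      cover-in (inner i)   =
        let (q , h) = PPD.bag-cover (block (rep-isRep i)) _ in inBlock _ q (∈blockBag _ h)
      cover-in (outside _) = let (j , h) = D′.bag-cover (D′.part (κ v)) in inTail j (∈-image⁺ h)

    private
      Both : V G → V G → Set
      Both u v = Any (λ B → label u ∈ B × label v ∈ B) bags

      swap-both : ∀ {u v} → Both u v → Both v u
      swap-both = Any.map (λ (hu , hv) → hv , hu)

      with-core : ∀ {v} → Inner v → ∀ {i} → i ∈ core → Any (λ B → label v ∈ B × i ∈ B) bags
      with-core {v} i i∈core =
        let ρ = rep-isRep i
            (q , h) = PPD.bag-cover (block ρ) (PPD.part (block ρ) v) in
        inBlock ρ q (subst (_∈ blockBag ρ q) (sym (label≡ (inner i))) (∈blockBag ρ h) ,
                     core⊆blockBag ρ q i∈core)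

      block-edge : ∀ {u v} (i : Inner u) → v ∈ comp (rep u) → u ∈ H → v ∈ H →
        label u ≢ label v → E G u v → Both u v
      block-edge {u} {v} i v∈comp u∈H v∈H ne e =
        inBlock ρ q (subst (_∈ blockBag ρ q) (sym lu) (∈blockBag ρ hu) ,
                     subst (_∈ blockBag ρ q) (sym lv) (∈blockBag ρ hv))
        where
        ρ = rep-isRep i
        d = block ρ
        lu = label-block ρ (member-of-rep i)
        lv = label-block ρ v∈comp
        found = PPD.bag-edge d (PPD.part d u) (PPD.part d v)
                  (λ eq → ne (trans lu (trans (cong (blockLabel ρ) eq) (sym lv))))
                  (u , v , ∈H⇒∈block ρ (member-of-rep i) u∈H , ∈H⇒∈block ρ v∈comp v∈H , refl , refl , e)
        q  = proj₁ found
        hu = proj₁ (proj₂ found)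
        hv = proj₂ (proj₂ found)

      outer-edge : ∀ {u v} → u ∉ A → v ∉ A → u ∈ H → v ∈ H → label u ≢ label v → E G u v →
        Dec (κ u ≡ κ v) → Both u v
      outer-edge u∉A v∉A _ _ ne _ (yes eq) =
        contradiction (trans (label-outside u∉A)
                        (trans (cong (outLabel ∘ D′.part) eq) (sym (label-outside v∉A)))) ne
      outer-edge {u} {v} u∉A v∉A u∈H v∈H ne e (no κu≢κv) =
        inTail j (subst (_∈ tailBag j) (sym (label-outside u∉A)) (∈-image⁺ hu) ,
                  subst (_∈ tailBag j) (sym (label-outside v∉A)) (∈-image⁺ hv))
        where
        found = D′.bag-edge (D′.part (κ u)) (D′.part (κ v))
                  (λ eq → ne (trans (label-outside u∉A) (trans (cong outLabel eq) (sym (label-outside v∉A)))))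
                  (κ u , κ v , ∈H⁻ (outside u∉A) u∈H , ∈H⁻ (outside v∉A) v∈H , refl , refl ,
                   E-quotient⁺ κu≢κv e)
        j  = proj₁ found
        hu = proj₁ (proj₂ found)
        hv = proj₂ (proj₂ found)

      edge-in : ∀ {u v} → Zone u → Zone v → u ∈ H → v ∈ H → label u ≢ label v → E G u v → Both u v
      edge-in (root refl)   (root refl)   _ _ ne _ = contradiction refl ne
      edge-in {v = v} (root refl) (inner i) _ _ _ _ = swap-both {v} {r} (with-core i label-r∈core)
      edge-in (root refl)   (outside v∉A) _ _ _  e = here (label-r∈core , label-X∈core (leaving-A r∈A v∉A e))
      edge-in (inner i)     (root refl)   _ _ _  _ = with-core i label-r∈core
      edge-in (inner i)     (inner j)     u∈H v∈H ne e =
        block-edge i (comp-step (member-of-rep i) (inner⇒G−X−r j) e) u∈H v∈H ne e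
      edge-in (inner i)     (outside v∉A) _ _ _  e = with-core i (label-X∈core (leaving-A (proj₁ i) v∉A e))
      edge-in {u} (outside u∉A) (root refl) _ _ _ e =
        swap-both {r} {u} (here (label-r∈core , label-X∈core (leaving-A r∈A u∉A (E-sym {G} e))))
      edge-in {u} {v} (outside u∉A) (inner j) _ _ _ e =
        swap-both {v} {u} (with-core j (label-X∈core (leaving-A (proj₁ j) u∉A (E-sym {G} e))))
      edge-in {u} {v} (outside u∉A) (outside v∉A) u∈H v∈H ne e = outer-edge u∉A v∉A u∈H v∈H ne e (κ u ≟ κ v)

    bag-edge : ∀ u v → u ∈ H → v ∈ H → label u ≢ label v → E G u v → Both u v
    bag-edge u v = edge-in (zone u) (zone v)

    private
      tail-convex : ∀ p → Convex (λ j → outLabel p ∈ tailBag j)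
      tail-convex p = convex-⇔ (λ _ → ∈-image⁺) (λ _ → injective⇒∈-image⁻ outLabel-injective) (D′.bag-path p)

      root-contiguous : Contiguous (rootLabel ∈_) bags
      root-contiguous =
        start (all-++-prefixed (rootLabel∈core ∷ allBlocks-All (λ ρ q → core⊆blockBag ρ q rootLabel∈core))
                               (stop (All.tabulate⁺ (∉tailBag (λ p eq → ↑ˡ≢↑ʳ _ _ (sym eq))))))

      block-contiguous : ∀ {u} (ρ : IsRep u) p → Contiguous (blockLabel ρ p ∈_) bags
      block-contiguous {u} ρ p =
        skip (blockLabel∉core ρ)
          (contiguous-++-none (contiguous-concat blockBags u own others)
                              (All.tabulate⁺ (∉tailBag (λ p eq → blockLabel≢outLabel ρ (sym eq)))))
        where
        own : Contiguous (blockLabel ρ p ∈_) (blockBags u)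
        own = subst (Contiguous (blockLabel ρ p ∈_)) (sym (blockBags-rep ρ))
          (tabulate-contiguous (_ ∈?_) (blockBag ρ)
            (convex-⇔ (λ _ → ∈blockBag ρ)
                      (λ q h → [ (λ h′ → contradiction h′ (blockLabel∉core ρ)) ,
                                 injective⇒∈-image⁻ (blockLabel-injective ρ) ]′ (x∈p∪q⁻ _ _ h))
                      (PPD.bag-path (block ρ) p)))
        others : ∀ u′ → u′ ≢ u → All (λ B → blockLabel ρ p ∉ B) (blockBags u′)
        others u′ u′≢u = blockBags-All u′ λ ρ′ →
          ∉blockBag ρ′ (blockLabel∉core ρ) (λ _ eq → u′≢u (blockLabel-separates ρ′ ρ eq))

      X-contiguous : Contiguous (outLabel (D′.part r′) ∈_) bags
      X-contiguous =
        let (j₀ , j₀≡0 , r′∈j₀) = r′-first in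
        start (all-++-prefixed (xLabel∈core ∷ allBlocks-All (λ ρ q → core⊆blockBag ρ q xLabel∈core))
                               (tabulate-prefixed (_ ∈?_) tailBag (tail-convex _) j₀ j₀≡0 (∈-image⁺ r′∈j₀)))

      outer-contiguous : ∀ {p} → p ≢ D′.part r′ → Contiguous (outLabel p ∈_) bags
      outer-contiguous p≢ =
        skip (outLabel∉core p≢)
          (none-++-contiguous (allBlocks-All λ ρ →
                                 ∉blockBag ρ (outLabel∉core p≢) (λ _ → blockLabel≢outLabel ρ))
                              (tabulate-contiguous (_ ∈?_) tailBag (tail-convex _)))

      contiguous-in : ∀ {v} (z : Zone v) → Contiguous (labelIn v z ∈_) bags
      contiguous-in (root _)        = root-contiguous
      contiguous-in {v} (inner i)   = block-contiguous (rep-isRep i) _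
      contiguous-in {v} (outside _) = by-part (D′.part (κ v) ≟ D′.part r′)
        where
        by-part : Dec (D′.part (κ v) ≡ D′.part r′) → Contiguous (outLabel (D′.part (κ v)) ∈_) bags
        by-part (yes same) = subst (λ p → Contiguous (outLabel p ∈_) bags) (sym same) X-contiguous
        by-part (no p≢)    = outer-contiguous p≢

    bag-contiguous : ∀ v → v ∈ H → Contiguous (label v ∈_) bags
    bag-contiguous v _ = contiguous-in (zone v)

    private
      κ∈H′ : ∀ {v} → Dec (v ∈ A) → v ∈ H → κ v ∈ D′.H
      κ∈H′ (yes v∈A) _   = subst (_∈ D′.H) (sym (κ≡r′⁺ (inj₁ v∈A))) r′∈H′
      κ∈H′ (no v∉A)  v∈H = ∈H⁻ (outside v∉A) v∈H

    private
      Neighbours : Subset n → Subset N → Set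
      Neighbours C B = ∀ c v → c ∈ C → v ∉ C → E G c v → v ∈ H × label v ∈ B

      module _ {C} (C-comp : Component G (λ v → Everything G v × v ∉ H) C) where

        private
          c∉H : ∀ {c} → c ∈ C → c ∉ H
          c∉H h = proj₂ (proj₁ C-comp _ h)

          C-walk : ∀ c c′ → c ∈ C → c′ ∈ C → WalkIn G C c c′
          C-walk = proj₂ (proj₁ (proj₂ C-comp))

        C⊆G−X−r : ∀ {c} → c ∈ C → G−X−r c
        C⊆G−X−r h = (λ c∈X → c∉H h (X⊆H c∈X)) , (λ c≡r → c∉H h (subst (_∈ H) (sym c≡r) root∈H))

        inner-component : ∀ {c₀} → c₀ ∈ C → Inner c₀ → Any (Neighbours C) bags
        inner-component {c₀} c₀∈C i = inBlock ρ j neighbours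
          where
          ρ = rep-isRep i
          d = block ρ
          C⊆comp : ∀ {c} → c ∈ C → c ∈ comp (rep c₀)
          C⊆comp h = comp-trans (member-of-rep i)
            (comp⁺ (walk-mono (λ h′ → ∈-toSubset⁺ _ (C⊆G−X−r h′)) (C-walk c₀ _ c₀∈C h)))
          found = PPD.comp d C (component-restrict C-comp
                    (λ c h → C⊆comp h , λ c∈d → c∉H h (∈block⇒∈H ρ c∈d))
                    (λ v (v∈comp , v∉d) → tt , λ v∈H → v∉d (∈H⇒∈block ρ v∈comp v∈H)))
          j = proj₁ found
          neighbours : Neighbours C (blockBag ρ j)
          neighbours c v c∈C v∉C e = by-position (G−X−r? v)
            where
            by-position : Dec (G−X−r v) → v ∈ H × label v ∈ blockBag ρ j
            by-position (yes v∉Xr) =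
              let v∈comp     = comp-step (C⊆comp c∈C) v∉Xr e
                  (v∈d , pv) = proj₂ found c v c∈C v∈comp v∉C e in
              ∈block⇒∈H ρ v∈d , subst (_∈ blockBag ρ j) (sym (label-block ρ v∈comp)) (∈blockBag ρ pv)
            by-position (no ¬v∉Xr) =
              let (v∈H , v∈core) = attached (v ≟ r) (v ∈? X) ¬v∉Xr in v∈H , core⊆blockBag ρ j v∈core

        outer-component : ∀ {c₀} → c₀ ∈ C → c₀ ∉ A → Any (Neighbours C) bags
        outer-component {c₀} c₀∈C c₀∉A = inTail j neighbours
          where
          C∌A : ∀ {c} → c ∈ C → c ∉ A
          C∌A h c∈A = c₀∉A (closed-walk (λ _ _ w∈A v∈C e → A-closed w∈A (proj₁ (C⊆G−X−r v∈C)) e) c∈A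
                                        (C-walk _ c₀ h c₀∈C))
          found = D′.comp (image κ C) (component-image (component-restrict C-comp
                    (λ c h → tt , λ κc∈H′ → c∉H h (∈H⁺ (outside (C∌A h)) κc∈H′))
                    (λ v (_ , κv∉H′) → tt , λ v∈H → κv∉H′ (κ∈H′ (v ∈? A) v∈H))))
          j = proj₁ found
          neighbours : Neighbours C (tailBag j)
          neighbours c v c∈C v∉C e =
            ∈H⁺ (outside v∉A) (proj₁ nb) ,
            subst (_∈ tailBag j) (sym (label-outside v∉A)) (∈-image⁺ (proj₂ nb))
            where
            v∉A : v ∉ A
            v∉A v∈A = C∌A c∈C (A-closed v∈A (proj₁ (C⊆G−X−r c∈C)) (E-sym {G} e))
            κv∉image : κ v ∉ image κ C
            κv∉image h = let (c′ , c′∈C , eq) = ∈-image⁻ h in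
              v∉C (subst (_∈ C) (κ-injective eq (outer-κ≢r′ (C∌A c′∈C) (proj₁ (C⊆G−X−r c′∈C)))) c′∈C)
            nb = proj₂ found (κ c) (κ v) (∈-image⁺ c∈C) tt κv∉image
                   (E-quotient⁺ (λ eq → κv∉image (subst (_∈ image κ C) eq (∈-image⁺ c∈C))) e)

    bag-comp : ∀ C → Component G (λ v → Everything G v × v ∉ H) C → Any (Neighbours C) bags
    bag-comp C C-comp = by-zone (zone c₀)
      where
      c₀   = proj₁ (proj₁ (proj₁ (proj₂ C-comp)))
      c₀∈C = proj₂ (proj₁ (proj₁ (proj₂ C-comp)))
      by-zone : Zone c₀ → Any (Neighbours C) bags
      by-zone (root c₀≡r)   = contradiction (subst (_∈ H) (sym c₀≡r) root∈H) (proj₂ (proj₁ C-comp _ c₀∈C))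
      by-zone (inner i)     = inner-component C-comp c₀∈C i
      by-zone (outside c₀∉A) = outer-component C-comp c₀∈C c₀∉A

    draft : Draft x (y + 2) G S r
    draft = record
      { N              = N
      ; H              = H
      ; S⊆H            = S⊆H
      ; label          = label
      ; class-width    = class-width
      ; firstBag       = core
      ; laterBags      = laterBags
      ; bag-width      = bag-width
      ; bag-cover      = bag-cover
      ; bag-edge       = bag-edge
      ; bag-contiguous = bag-contiguous
      ; bag-comp       = bag-comp
      ; root∈H         = root∈H
      ; root-alone     = λ v _ eq → label-root⁻ (trans eq label-root)
      ; root-first     = label-r∈core
      }

lemma19 : (G : Graph) → Connected G ⊤ → (S : VPred G) →
  (x y : ℕ) → 1 ≤ x → (r : V G) →
  (X : Subset (Graph.n G)) → r ∉ X → ∣ X ∣ ≤ x →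
  (∀ v → v ∈ X → PathAvoiding G X r v) →
  (∀ C → Component G (λ v → v ∉ X × v ≢ r) C →
    (∃ λ u → u ∈ C × E G r u) →
    Σ (PPD x G (λ v → v ∈ C) (λ v → S v × v ∈ C)) (λ d → Width≤ d y)) →
  (∀ (G' : Graph) → Graph.n G' < Graph.n G → (M : Model G' G) → (r' : V G') →
    r ∈ Model.branch M r' →
    Σ (PPD x G' (Everything G') (ImageSet M S)) (λ d → Width≤ d (y + 2) × Rooted d r')) →
  Σ (PPD x G (Everything G) S) (λ d → Width≤ d (y + 2) × Rooted d r)
lemma19 G connected S x y 1≤x r X r∉X ∣X∣≤x paths decompose decomposeMinor =
  compact (by-contraction (Fin.any? λ v → ¬? (v ∈? K)))
  where
  open Collapse G r X r∉X paths
  by-contraction : Dec (∃ λ v → v ∉ K) → Draft x (y + 2) G S r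
  by-contraction (yes (v , v∉K)) =
    let (d′ , d′-width , d′-rooted) = decomposeMinor G′ (G′-smaller v∉K) model r′ r∈branch in
    Glue.draft G S x y r X r∉X 1≤x ∣X∣≤x paths decompose d′ d′-width d′-rooted
  by-contraction (no nothing-outside) =
    single-vertex-draft 1≤x (nothing-contracted connected λ v → kept v (v ∈? K))
    where
    kept : ∀ v → Dec (v ∈ K) → v ∈ K
    kept v (yes v∈K) = v∈K
    kept v (no v∉K)  = contradiction (v , v∉K) nothing-outside
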